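{- Let $n \geq 4$ be even, $m=2n-1$, let $D$ be the distance matrix of the helm graph $H_n$ and let $\mathcal{L}$ be the special Laplacian matrix of $H_n$. Define $u:=\frac{1}{4}(5-n,-1,\dots,-1,2,\dots,2)' \in \mathbb{R}^{m}$, where the entry $-1$ appears $n-1$ times and the entry $2$ appears $n-1$ times. Then \[D^{ -1} = -\frac{1}{2}\mathcal{L}+\frac{4}{3(n-1)}uu'.\]
   Context: For $n\ge 4$, the wheel graph $W_n$ has vertex set $\{1,\dots,n\}$: vertex $1$ is the center, adjacent to all others, and vertices $2,3,\dots,n$ form a cycle in this cyclic order. The helm graph $H_n$ on $m:=2n-1$ vertices is obtained from $W_n$ by adding vertices $n+1,\dots,m$ and the pendant edges $(j,n+j-1)$ for $2\le j\le n$. The distance matrix $D$ of $H_n$ is the $m\times m$ matrix of shortest-path distances, rows/columns indexed $1,\dots,m$. Notation: $\mathbf{1}$ is the all-ones vector in $\mathbb{R}^{n-1}$, $I$ and $J$ the $(n-1)\times(n-1)$ identity and all-ones matrices. For $s=(s_1,\dots,s_\mu)'$, ${\rm Circ}(s')$ is the $\mu\times\mu$ circulant matrix whose first row is $s'$ and each subsequent row is the cyclic right shift of the previous one (row $i$ has $(i,j)$ entry $s_{((j-i) \bmod \mu)+1}$). For $n$ even and $k\in\{1,\dots,\frac n2-1\}$, let $c^k\in\mathbb{R}^{n-1}$ have $c^k_j=1$ if $j=k+1$ or $j=n-k$, and $c^k_j=0$ otherwise, and let $C_k:={\rm Circ}({c^k}')$. The special Laplacian of $H_n$ is the $m\times m$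 matrix \[\mathcal{L} := \frac{1}{2}\begin{bmatrix} n-1 & -\mathbf{1}' & 0\\ -\mathbf{1}& (n+1) I & -2I\\ 0 & -2I & 2I\end{bmatrix}+\sum_{k=1}^{\frac{n}{2}-1}(-1)^{k}\frac{(n-1)-2k}{2}\begin{bmatrix} 0 & 0 & 0\\ 0& C_k & 0\\ 0 & 0 & 0\end{bmatrix},\] with blocks of sizes $1, n-1, n-1$. -}

module Defs where

open import Data.Nat as ℕ using (ℕ; zero; suc; _∸_; _≤ᵇ_; _≡ᵇ_)
open import Data.Nat.DivMod using (_%_; _/_)
open import Data.Integer as ℤ using (ℤ; +_)
open import Data.Rational as ℚ using (ℚ; 0ℚ; 1ℚ; ½)
open import Data.Fin using (Fin; toℕ)
open import Data.Bool using (Bool; true; false; _∧_; _∨_; if_then_else_; not)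

Matrix : ℕ → Set
Matrix k = Fin k → Fin k → ℚ

sumFin : ∀ {k} → (Fin k → ℚ) → ℚ
sumFin {zero}  f = 0ℚ
sumFin {suc k} f = f Data.Fin.zero ℚ.+ sumFin (λ i → f (Data.Fin.suc i))

anyFin : ∀ {k} → (Fin k → Bool) → Bool
anyFin {zero}  f = false
anyFin {suc k} f = f Data.Fin.zero ∨ anyFin (λ i → f (Data.Fin.suc i))

_·_ : ∀ {k} → Matrix k → Matrix k → Matrix k
(A · B) i j = sumFin (λ l → A i l ℚ.* B l j)

identity : ∀ {k} → Matrix k
identity i j = if toℕ i ≡ᵇ toℕ j then 1ℚ else 0ℚ

sumTo : ℕ → (ℕ → ℚ) → ℚ
sumTo zero    f = 0ℚ
sumTo (suc t) f = sumTo t f ℚ.+ f (suc t)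

signPow : ℕ → ℚ
signPow zero    = 1ℚ
signPow (suc k) = ℚ.- signPow k

reachWithin : ∀ {k} → (Fin k → Fin k → Bool) → ℕ → Fin k → Fin k → Bool
reachWithin adj zero    i j = toℕ i ≡ᵇ toℕ j
reachWithin adj (suc t) i j =
  reachWithin adj t i j ∨ anyFin (λ l → reachWithin adj t i l ∧ adj l j)

-- least fuel p : least t < fuel with p t = true (fuel if none).
least : ℕ → (ℕ → Bool) → ℕ
least zero     p = zero
least (suc f)  p = if p zero then zero else suc (least f (λ t → p (suc t)))

-- Shortest-path distance (for a connected graph on k vertices, the
-- distance is < k, so the search bound k suffices).
graphDist : ∀ {k} → (Fin k → Fin k → Bool) → Fin k → Fin k → ℕ
graphDist {k} adj i j = least k (λ t → reachWithin adj t i j)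

-- Helm graph H_n on m = 2n-1 vertices, labels 1..m as in the paper.

helmOrder : ℕ → ℕ
helmOrder n = 2 ℕ.* n ∸ 1

inRange : ℕ → ℕ → ℕ → Bool
inRange lo hi a = (lo ≤ᵇ a) ∧ (a ≤ᵇ hi)

helmEdge : ℕ → ℕ → ℕ → Bool
helmEdge n a b =
     ((a ≡ᵇ 1) ∧ inRange 2 n b)
  ∨ (inRange 2 (n ∸ 1) a ∧ (b ≡ᵇ suc a))
  ∨ ((a ≡ᵇ n) ∧ (b ≡ᵇ 2))
  ∨ (inRange 2 n a ∧ (b ≡ᵇ n ℕ.+ a ∸ 1))

helmAdjℕ : ℕ → ℕ → ℕ → Bool
helmAdjℕ n a b = helmEdge n a b ∨ helmEdge n b a

lbl : ∀ {k} → Fin k → ℕ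
lbl i = suc (toℕ i)

helmAdj : (n : ℕ) → Fin (helmOrder n) → Fin (helmOrder n) → Bool
helmAdj n i j = helmAdjℕ n (lbl i) (lbl j)

helmDist : (n : ℕ) → Matrix (helmOrder n)
helmDist n i j = (+ graphDist (helmAdj n) i j) ℚ./ 1

-- Circ(s') for μ = suc μ', 1-based indices: (i,j) entry s_{((j-i) mod μ)+1}.
circ : (μ' : ℕ) → (ℕ → ℚ) → ℕ → ℕ → ℚ
circ μ' s i j = s (suc ((j ℕ.+ suc μ' ∸ i) % suc μ'))

cvec : ℕ → ℕ → ℕ → ℚ
cvec n k j = if (j ≡ᵇ suc k) ∨ (j ≡ᵇ n ∸ k) then 1ℚ else 0ℚ

-- C_k = Circ(c^k'), of size n-1 = suc (n ∸ 2) (n ≥ 4).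
Cmat : ℕ → ℕ → ℕ → ℕ → ℚ
Cmat n k p q = circ (n ∸ 2) (cvec n k) p q

frac : ℤ → ℕ → ℚ
frac a d = a ℚ./ suc (d ∸ 1)   -- only used with d ≥ 1

lapBase : ℕ → ℕ → ℕ → ℚ
lapBase n a b =
  if (a ≡ᵇ 1) ∧ (b ≡ᵇ 1) then ½ ℚ.* ((+ (n ∸ 1)) ℚ./ 1)
  else if ((a ≡ᵇ 1) ∧ inRange 2 n b) ∨ ((b ≡ᵇ 1) ∧ inRange 2 n a) then ½ ℚ.* (ℚ.- 1ℚ)
  else if inRange 2 n a ∧ (a ≡ᵇ b) then ½ ℚ.* ((+ suc n) ℚ./ 1)
  else if (inRange 2 n a ∧ (b ≡ᵇ n ℕ.+ a ∸ 1)) ∨ (inRange 2 n b ∧ (a ≡ᵇ n ℕ.+ b ∸ 1))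
    then ½ ℚ.* ((ℤ.- (+ 2)) ℚ./ 1)
  else if inRange (suc n) (helmOrder n) a ∧ (a ≡ᵇ b) then ½ ℚ.* ((+ 2) ℚ./ 1)
  else 0ℚ

lapCirc : ℕ → ℕ → ℕ → ℚ
lapCirc n a b =
  if inRange 2 n a ∧ inRange 2 n b
  then sumTo (n / 2 ∸ 1) (λ k →
         signPow k ℚ.* ((((+ (n ∸ 1)) ℤ.- (+ (2 ℕ.* k))) ℚ./ 2)
                   ℚ.* Cmat n k (a ∸ 1) (b ∸ 1)))
  else 0ℚ

specialLaplacian : (n : ℕ) → Matrix (helmOrder n)
specialLaplacian n i j = lapBase n (lbl i) (lbl j) ℚ.+ lapCirc n (lbl i) (lbl j)

uVec : (n : ℕ) → Fin (helmOrder n) → ℚ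
uVec n i =
  if lbl i ≡ᵇ 1 then ((+ 5) ℤ.- (+ n)) ℚ./ 4
  else if inRange 2 n (lbl i) then (ℤ.- (+ 1)) ℚ./ 4
  else (+ 2) ℚ./ 4

candidateInverse : (n : ℕ) → Matrix (helmOrder n)
candidateInverse n i j =
  (ℚ.- ½) ℚ.* specialLaplacian n i j
  ℚ.+ ((+ 4) ℚ./ suc (3 ℕ.* (n ∸ 1) ∸ 1)) ℚ.* (uVec n i ℚ.* uVec n j)

{-# OPTIONS --safe #-}
-- Write n = 2h + 4 and N = n − 1 for the rim length, D for the distance matrix, L for the
-- special Laplacian and X = −½ L + α u u' with α = 4/(3(n − 1)).  The two identities
--   D L = 2 𝟙 u' − 2 I   and   D u = (3(n − 1)/4) 𝟙
-- give D X = I − 𝟙 u' + 𝟙 u' = I, and X D = I follows because D and X are symmetric.  The rim distance c(p, s) ∈ {0, 1, 2} equals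
-- 2 − 2δ(p, s) − δ(p + 1, s) − δ(p − 1, s), so every rim sum ∑ₛ c(p, s) f(s) collapses to
-- 2 ∑ f − 2 f(p) − f(p + 1) − f(p − 1).  On the rim block L is I plus the circulant C with
-- entries (−1)^k (N − 2k)/2 at offsets ±k, and these coefficients are exactly what makes
-- C(p − 1, q) + C(p + 1, q) + 2 C(p, q) = 2 δ(p, q); each column of that block sums to 3/2.
module Submission where

open import Data.Nat as ℕ using (ℕ; zero; suc; _∸_; _≤ᵇ_; _≡ᵇ_; _<_; _≤_; z≤n; s≤s; _%_)
import Data.Nat.Properties as ℕP
import Data.Nat.DivMod as ℕD
open import Data.Nat.Divisibility using (_∣_; divides)
open import Data.Integer as ℤ using (ℤ)
import Data.Integer.Properties as ℤP
open import Data.Rational as ℚ using (ℚ; 0ℚ; 1ℚ; ½; _+_; _*_; -_; _-_)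
import Data.Rational.Properties as ℚP
import Data.Rational.Unnormalised as ℚᵘ
import Data.Rational.Unnormalised.Properties as ℚᵘP
open import Data.Rational.Solver using (module +-*-Solver)
open import Data.Fin as F using (Fin; toℕ; fromℕ<)
import Data.Fin.Properties as FP
open import Data.Bool using (Bool; true; false; _∧_; _∨_; if_then_else_; T)
import Data.Bool.Properties as BoolP
open import Data.Unit using (⊤; tt)
open import Data.Empty using (⊥-elim)
open import Data.Sum using (_⊎_; inj₁; inj₂)
open import Data.Product using (_×_; _,_; Σ; proj₁; proj₂)
open import Function using (_∘_)
open import Relation.Nullary using (¬_; yes; no)
open import Relation.Binary.Definitions using (tri<; tri≈; tri>)
open import Relation.Binary.PropositionalEquality
open import Defs
open +-*-Solver

T⇒≡true : ∀ {b} → T b → b ≡ true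
T⇒≡true {true} _ = refl

≡true⇒T : ∀ {b} → b ≡ true → T b
≡true⇒T refl = tt

¬T⇒≡false : ∀ {b} → ¬ T b → b ≡ false
¬T⇒≡false {true} ¬t = ⊥-elim (¬t tt)
¬T⇒≡false {false} _ = refl

≡true-ext : ∀ {a b : Bool} → (a ≡ true → b ≡ true) → (b ≡ true → a ≡ true) → a ≡ b
≡true-ext {true} {true} _ _ = refl
≡true-ext {true} {false} f _ = sym (f refl)
≡true-ext {false} {true} _ g = g refl
≡true-ext {false} {false} _ _ = refl

if-true : ∀ {A : Set} {b : Bool} (x y : A) → b ≡ true → (if b then x else y) ≡ x
if-true x y refl = refl

if-false : ∀ {A : Set} {b : Bool} (x y : A) → b ≡ false → (if b then x else y) ≡ y
if-false x y refl = refl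

∨-introˡ : ∀ {x y} → x ≡ true → (x ∨ y) ≡ true
∨-introˡ refl = refl

∨-introʳ : ∀ {x y} → y ≡ true → (x ∨ y) ≡ true
∨-introʳ {true} _ = refl
∨-introʳ {false} e = e

∨-elim : ∀ {x y} → (x ∨ y) ≡ true → (x ≡ true) ⊎ (y ≡ true)
∨-elim {true} _ = inj₁ refl
∨-elim {false} e = inj₂ e

∨-false : ∀ {x y} → x ≡ false → y ≡ false → (x ∨ y) ≡ false
∨-false refl e = e

∧-intro : ∀ {x y} → x ≡ true → y ≡ true → (x ∧ y) ≡ true
∧-intro refl e = e

∧-elim : ∀ {x y} → (x ∧ y) ≡ true → (x ≡ true) × (y ≡ true)
∧-elim {true} e = refl , e

∧-falseˡ : ∀ {x y} → x ≡ false → (x ∧ y) ≡ false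
∧-falseˡ refl = refl

∧-falseʳ : ∀ {x y} → y ≡ false → (x ∧ y) ≡ false
∧-falseʳ {true} e = e
∧-falseʳ {false} _ = refl

∨-false-true : ∀ {x y} → x ≡ false → y ≡ true → (x ∨ y) ≡ true
∨-false-true refl e = e

≡ᵇ-refl : ∀ m → (m ≡ᵇ m) ≡ true
≡ᵇ-refl zero = refl
≡ᵇ-refl (suc m) = ≡ᵇ-refl m

≡ᵇ-sym : ∀ m n → (m ≡ᵇ n) ≡ (n ≡ᵇ m)
≡ᵇ-sym zero zero = refl
≡ᵇ-sym zero (suc n) = refl
≡ᵇ-sym (suc m) zero = refl
≡ᵇ-sym (suc m) (suc n) = ≡ᵇ-sym m n

≡ᵇ-true⇒≡ : ∀ m n → (m ≡ᵇ n) ≡ true → m ≡ n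
≡ᵇ-true⇒≡ m n e = ℕP.≡ᵇ⇒≡ m n (≡true⇒T e)

≡⇒≡ᵇ-true : ∀ {m n} → m ≡ n → (m ≡ᵇ n) ≡ true
≡⇒≡ᵇ-true {m} refl = ≡ᵇ-refl m

≢⇒≡ᵇ-false : ∀ m n → ¬ (m ≡ n) → (m ≡ᵇ n) ≡ false
≢⇒≡ᵇ-false m n m≢n = ¬T⇒≡false (λ t → m≢n (ℕP.≡ᵇ⇒≡ m n t))

≤⇒≤ᵇ-true : ∀ {m n} → m ≤ n → (m ≤ᵇ n) ≡ true
≤⇒≤ᵇ-true m≤n = T⇒≡true (ℕP.≤⇒≤ᵇ m≤n)

>⇒≤ᵇ-false : ∀ {m n} → n < m → (m ≤ᵇ n) ≡ false
>⇒≤ᵇ-false {m} {n} n<m = ¬T⇒≡false (λ t → ℕP.<⇒≱ n<m (ℕP.≤ᵇ⇒≤ m n t))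

≤ᵇ-true⇒≤ : ∀ m n → (m ≤ᵇ n) ≡ true → m ≤ n
≤ᵇ-true⇒≤ m n e = ℕP.≤ᵇ⇒≤ m n (≡true⇒T e)

fromℤ : ℤ → ℚ
fromℤ z = z ℚ./ 1

fromℕ : ℕ → ℚ
fromℕ k = (ℤ.+ k) ℚ./ 1

-- Identities between normalised rationals are proved in ℚᵘ, where the operations are plain
-- fraction arithmetic, and transported back along the injective toℚᵘ.
private
  lift : ∀ {p q} → ℚ.toℚᵘ p ℚᵘ.≃ ℚ.toℚᵘ q → p ≡ q
  lift = ℚP.toℚᵘ-injective

  toℚᵘ-/ : ∀ z d → ℚ.toℚᵘ (z ℚ./ suc d) ℚᵘ.≃ ℚᵘ.mkℚᵘ z d
  toℚᵘ-/ z d = ℚP.toℚᵘ-fromℚᵘ (ℚᵘ.mkℚᵘ z d)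

open ℚᵘP using (≃-trans; ≃-sym)

fromℤ-+ : ∀ a b → fromℤ (a ℤ.+ b) ≡ fromℤ a + fromℤ b
fromℤ-+ a b = lift (≃-trans (toℚᵘ-/ (a ℤ.+ b) 0)
  (≃-sym (≃-trans (ℚP.toℚᵘ-homo-+ (fromℤ a) (fromℤ b))
     (≃-trans (ℚᵘP.+-cong (toℚᵘ-/ a 0) (toℚᵘ-/ b 0))
       (ℚᵘ.*≡* (cong (ℤ._* (ℤ.+ 1)) (cong₂ ℤ._+_ (ℤP.*-identityʳ a) (ℤP.*-identityʳ b))))))))

fromℤ-* : ∀ a b → fromℤ (a ℤ.* b) ≡ fromℤ a * fromℤ b
fromℤ-* a b = lift (≃-trans (toℚᵘ-/ (a ℤ.* b) 0)
  (≃-sym (≃-trans (ℚP.toℚᵘ-homo-* (fromℤ a) (fromℤ b))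
     (ℚᵘP.*-cong (toℚᵘ-/ a 0) (toℚᵘ-/ b 0)))))

fromℤ-neg : ∀ a → fromℤ (ℤ.- a) ≡ - fromℤ a
fromℤ-neg a = lift (≃-trans (toℚᵘ-/ (ℤ.- a) 0)
  (≃-sym (≃-trans (ℚP.toℚᵘ-homo‿- (fromℤ a)) (ℚᵘP.-‿cong (toℚᵘ-/ a 0)))))

/-as-* : ∀ z d → z ℚ./ suc d ≡ fromℤ z * ((ℤ.+ 1) ℚ./ suc d)
/-as-* z d = lift (≃-trans (toℚᵘ-/ z d)
  (≃-sym (≃-trans (ℚP.toℚᵘ-homo-* (fromℤ z) ((ℤ.+ 1) ℚ./ suc d))
     (≃-trans (ℚᵘP.*-cong (toℚᵘ-/ z 0) (toℚᵘ-/ (ℤ.+ 1) d))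
       (ℚᵘ.*≡* (trans (cong (ℤ._* (ℤ.+ suc d)) (ℤP.*-identityʳ z))
                      (cong (λ k → z ℤ.* (ℤ.+ suc k)) (sym (ℕP.+-identityʳ d)))))))))

fromℕ-*-recip : ∀ d → fromℕ (suc d) * ((ℤ.+ 1) ℚ./ suc d) ≡ 1ℚ
fromℕ-*-recip d = lift (≃-trans (ℚP.toℚᵘ-homo-* (fromℕ (suc d)) ((ℤ.+ 1) ℚ./ suc d))
  (≃-trans (ℚᵘP.*-cong (toℚᵘ-/ (ℤ.+ suc d) 0) (toℚᵘ-/ (ℤ.+ 1) d))
    (ℚᵘ.*≡* (trans (trans (ℤP.*-identityʳ _) (ℤP.*-identityʳ (ℤ.+ suc d)))
                   (trans (cong (λ k → ℤ.+ suc k) (sym (ℕP.+-identityʳ d))) (sym (ℤP.*-identityˡ _)))))))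

fromℕ-+ : ∀ a b → fromℕ (a ℕ.+ b) ≡ fromℕ a + fromℕ b
fromℕ-+ a b = trans (cong fromℤ (ℤP.pos-+ a b)) (fromℤ-+ (ℤ.+ a) (ℤ.+ b))

fromℕ-* : ∀ a b → fromℕ (a ℕ.* b) ≡ fromℕ a * fromℕ b
fromℕ-* a b = trans (cong fromℤ (ℤP.pos-* a b)) (fromℤ-* (ℤ.+ a) (ℤ.+ b))

fromℕ-suc : ∀ a → fromℕ (suc a) ≡ 1ℚ + fromℕ a
fromℕ-suc a = fromℕ-+ 1 a

fromℤ-sub : ∀ a b → fromℤ ((ℤ.+ a) ℤ.- (ℤ.+ b)) ≡ fromℕ a - fromℕ b
fromℤ-sub a b = trans (fromℤ-+ (ℤ.+ a) (ℤ.- (ℤ.+ b))) (cong (fromℕ a +_) (fromℤ-neg (ℤ.+ b)))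

+-interchange : ∀ a b c d → (a + b) + (c + d) ≡ (a + c) + (b + d)
+-interchange = solve 4 (λ a b c d → (a :+ b) :+ (c :+ d) := (a :+ c) :+ (b :+ d)) refl

sumℕ : ℕ → (ℕ → ℚ) → ℚ
sumℕ zero f = 0ℚ
sumℕ (suc k) f = f 0 + sumℕ k (λ t → f (suc t))

sumFin≡sumℕ : ∀ k (g : Fin k → ℚ) (f : ℕ → ℚ) → (∀ i → g i ≡ f (toℕ i)) → sumFin g ≡ sumℕ k f
sumFin≡sumℕ zero g f e = refl
sumFin≡sumℕ (suc k) g f e = cong₂ _+_ (e F.zero)
  (sumFin≡sumℕ k (λ i → g (F.suc i)) (λ t → f (suc t)) (λ i → e (F.suc i)))

sumℕ-cong : ∀ k (f g : ℕ → ℚ) → (∀ t → t < k → f t ≡ g t) → sumℕ k f ≡ sumℕ k g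
sumℕ-cong zero f g e = refl
sumℕ-cong (suc k) f g e = cong₂ _+_ (e 0 (s≤s z≤n))
  (sumℕ-cong k (λ t → f (suc t)) (λ t → g (suc t)) (λ t t<k → e (suc t) (s≤s t<k)))

sumℕ-+ : ∀ k (f g : ℕ → ℚ) → sumℕ k (λ t → f t + g t) ≡ sumℕ k f + sumℕ k g
sumℕ-+ zero f g = sym (ℚP.+-identityˡ 0ℚ)
sumℕ-+ (suc k) f g = trans (cong (f 0 + g 0 +_) (sumℕ-+ k (λ t → f (suc t)) (λ t → g (suc t))))
  (+-interchange (f 0) (g 0) (sumℕ k (λ t → f (suc t))) (sumℕ k (λ t → g (suc t))))

sumℕ-* : ∀ k c (f : ℕ → ℚ) → sumℕ k (λ t → c * f t) ≡ c * sumℕ k f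
sumℕ-* zero c f = sym (ℚP.*-zeroʳ c)
sumℕ-* (suc k) c f = trans (cong (c * f 0 +_) (sumℕ-* k c (λ t → f (suc t))))
  (sym (ℚP.*-distribˡ-+ c (f 0) (sumℕ k (λ t → f (suc t)))))

sumℕ-neg : ∀ k (f : ℕ → ℚ) → sumℕ k (λ t → - f t) ≡ - sumℕ k f
sumℕ-neg zero f = refl
sumℕ-neg (suc k) f = trans (cong (- f 0 +_) (sumℕ-neg k (λ t → f (suc t))))
  (sym (ℚP.neg-distrib-+ (f 0) _))

sumℕ-split : ∀ a b (f : ℕ → ℚ) → sumℕ (a ℕ.+ b) f ≡ sumℕ a f + sumℕ b (λ t → f (a ℕ.+ t))
sumℕ-split zero b f = sym (ℚP.+-identityˡ _)
sumℕ-split (suc a) b f = trans (cong (f 0 +_) (sumℕ-split a b (λ t → f (suc t))))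
  (sym (ℚP.+-assoc (f 0) _ _))

sumℕ-last : ∀ k (f : ℕ → ℚ) → sumℕ (suc k) f ≡ sumℕ k f + f k
sumℕ-last k f = trans (cong (λ m → sumℕ m f) (ℕP.+-comm 1 k))
  (trans (sumℕ-split k 1 f)
         (cong (sumℕ k f +_) (trans (ℚP.+-identityʳ _) (cong f (ℕP.+-identityʳ k)))))

sumℕ-const : ∀ k c → sumℕ k (λ _ → c) ≡ fromℕ k * c
sumℕ-const zero c = sym (ℚP.*-zeroˡ c)
sumℕ-const (suc k) c = begin
  c + sumℕ k (λ _ → c)  ≡⟨ cong (c +_) (sumℕ-const k c) ⟩
  c + fromℕ k * c       ≡⟨ cong (_+ fromℕ k * c) (ℚP.*-identityˡ c) ⟨
  1ℚ * c + fromℕ k * c  ≡⟨ ℚP.*-distribʳ-+ c 1ℚ (fromℕ k) ⟨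
  (1ℚ + fromℕ k) * c    ≡⟨ cong (_* c) (fromℕ-suc k) ⟨
  fromℕ (suc k) * c     ∎
  where open ≡-Reasoning

sumℕ-zero : ∀ k (f : ℕ → ℚ) → (∀ t → f t ≡ 0ℚ) → sumℕ k f ≡ 0ℚ
sumℕ-zero k f e = trans (sumℕ-cong k f (λ _ → 0ℚ) (λ t _ → e t))
  (trans (sumℕ-const k 0ℚ) (ℚP.*-zeroʳ (fromℕ k)))

δ : ℕ → ℕ → ℚ
δ a b = if a ≡ᵇ b then 1ℚ else 0ℚ

δ-sym : ∀ a b → δ a b ≡ δ b a
δ-sym a b = cong (λ x → if x then 1ℚ else 0ℚ) (≡ᵇ-sym a b)

δ-refl : ∀ a → δ a a ≡ 1ℚ
δ-refl a = cong (λ x → if x then 1ℚ else 0ℚ) (≡ᵇ-refl a)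

δ-≢ : ∀ a b → ¬ (a ≡ b) → δ a b ≡ 0ℚ
δ-≢ a b a≢b = cong (λ x → if x then 1ℚ else 0ℚ) (≢⇒≡ᵇ-false a b a≢b)

sumℕ-δˡ : ∀ k p (f : ℕ → ℚ) → p < k → sumℕ k (λ t → δ p t * f t) ≡ f p
sumℕ-δˡ (suc k) zero f _ = trans (cong₂ _+_ (ℚP.*-identityˡ (f 0))
  (sumℕ-zero k (λ t → 0ℚ * f (suc t)) (λ t → ℚP.*-zeroˡ (f (suc t))))) (ℚP.+-identityʳ (f 0))
sumℕ-δˡ (suc k) (suc p) f (s≤s p<k) = trans (cong (_+ sumℕ k (λ t → δ p t * f (suc t))) (ℚP.*-zeroˡ (f 0)))
  (trans (ℚP.+-identityˡ _) (sumℕ-δˡ k p (λ t → f (suc t)) p<k))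

sumℕ-δʳ : ∀ k p (f : ℕ → ℚ) → p < k → sumℕ k (λ t → δ t p * f t) ≡ f p
sumℕ-δʳ k p f p<k = trans (sumℕ-cong k _ _ (λ t _ → cong (_* f t) (δ-sym t p))) (sumℕ-δˡ k p f p<k)

sumTo-zero : ∀ K (g : ℕ → ℚ) → (∀ k → 1 ≤ k → k ≤ K → g k ≡ 0ℚ) → sumTo K g ≡ 0ℚ
sumTo-zero zero g e = refl
sumTo-zero (suc K) g e = trans
  (cong₂ _+_ (sumTo-zero K g (λ k 1≤k k≤K → e k 1≤k (ℕP.m≤n⇒m≤1+n k≤K))) (e (suc K) (s≤s z≤n) ℕP.≤-refl))
  (ℚP.+-identityʳ 0ℚ)

sumTo-single : ∀ K j (f g : ℕ → ℚ) → 1 ≤ j → j ≤ K →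
  (∀ k → 1 ≤ k → k ≤ K → g k ≡ (if k ≡ᵇ j then f k else 0ℚ)) → sumTo K g ≡ f j
sumTo-single zero (suc j) f g _ () _
sumTo-single (suc K) j f g 1≤j j≤K e with j ℕP.≟ suc K
... | yes refl = trans (cong₂ _+_
        (sumTo-zero K g (λ k 1≤k k≤K → trans (e k 1≤k (ℕP.m≤n⇒m≤1+n k≤K))
           (if-false (f k) 0ℚ (≢⇒≡ᵇ-false k (suc K) (λ k≡ → ℕP.<-irrefl k≡ (s≤s k≤K))))))
        (trans (e (suc K) (s≤s z≤n) ℕP.≤-refl) (if-true (f (suc K)) 0ℚ (≡ᵇ-refl (suc K)))))
      (ℚP.+-identityˡ (f (suc K)))
... | no j≢ = trans (cong₂ _+_
        (sumTo-single K j f g 1≤j (ℕP.≤-pred (ℕP.≤∧≢⇒< j≤K j≢)) (λ k 1≤k k≤K → e k 1≤k (ℕP.m≤n⇒m≤1+n k≤K)))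
        (trans (e (suc K) (s≤s z≤n) ℕP.≤-refl) (if-false (f (suc K)) 0ℚ (≢⇒≡ᵇ-false (suc K) j (λ e′ → j≢ (sym e′))))))
      (ℚP.+-identityʳ (f j))

anyFin-elim : ∀ {k} (f : Fin k → Bool) → anyFin f ≡ true → Σ (Fin k) (λ l → f l ≡ true)
anyFin-elim {suc k} f e with ∨-elim {f F.zero} e
... | inj₁ e1 = F.zero , e1
... | inj₂ e2 with anyFin-elim (λ i → f (F.suc i)) e2
... | (l , el) = F.suc l , el

anyFin-intro : ∀ {k} (f : Fin k → Bool) (l : Fin k) → f l ≡ true → anyFin f ≡ true
anyFin-intro f F.zero e = ∨-introˡ e
anyFin-intro f (F.suc l) e = ∨-introʳ {f F.zero} (anyFin-intro (λ i → f (F.suc i)) l e)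

anyFin-cong : ∀ {k} (f g : Fin k → Bool) → (∀ l → f l ≡ g l) → anyFin f ≡ anyFin g
anyFin-cong {zero} f g e = refl
anyFin-cong {suc k} f g e = cong₂ _∨_ (e F.zero) (anyFin-cong (λ i → f (F.suc i)) (λ i → g (F.suc i)) (λ i → e (F.suc i)))

least-cong : ∀ f (p q : ℕ → Bool) → (∀ t → p t ≡ q t) → least f p ≡ least f q
least-cong zero p q e = refl
least-cong (suc f) p q e = cong₂ (λ b r → if b then 0 else suc r) (e 0) (least-cong f (λ t → p (suc t)) (λ t → q (suc t)) (λ t → e (suc t)))

≤ᵇ-suc : ∀ a b → (suc a ≤ᵇ suc b) ≡ (a ≤ᵇ b)
≤ᵇ-suc a b = ≡true-ext (λ e → ≤⇒≤ᵇ-true {a} {b} (ℕP.≤-pred (≤ᵇ-true⇒≤ (suc a) (suc b) e)))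
                       (λ e → ≤⇒≤ᵇ-true {suc a} {suc b} (s≤s (≤ᵇ-true⇒≤ a b e)))

least-≤ᵇ : ∀ f d → d < f → least f (λ t → d ≤ᵇ t) ≡ d
least-≤ᵇ (suc f) zero lt = refl
least-≤ᵇ (suc f) (suc d) (s≤s lt) = cong suc (trans (least-cong f _ _ (λ t → ≤ᵇ-suc d t)) (least-≤ᵇ f d lt))

TwoSidedInverse : ∀ {k} → Matrix k → Matrix k → Set
TwoSidedInverse A B = (∀ i j → (A · B) i j ≡ identity i j) × (∀ i j → (B · A) i j ≡ identity i j)

module Helm (h : ℕ) where

  K : ℕ
  K = suc (suc (h ℕ.+ h))
  N : ℕ
  N = suc K
  n : ℕ
  n = suc N

  [2+h]*2≡n : suc (suc h) ℕ.* 2 ≡ n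
  [2+h]*2≡n = cong (suc ∘ suc ∘ suc ∘ suc) (trans (ℕP.*-comm h 2) (cong (h ℕ.+_) (ℕP.+-identityʳ h)))

  -- With n = 2h + 4 and N = n − 1: paper vertex 1 is centre, vertex p + 2 is hub p and
  -- vertex n + p + 1 is pendant p (p < N); index is the 0-based position used by Fin.
  data Vertex : Set where
    centre : Vertex
    hub : ℕ → Vertex
    pendant : ℕ → Vertex

  IsVertex : Vertex → Set
  IsVertex centre = ⊤
  IsVertex (hub p) = p < N
  IsVertex (pendant p) = p < N

  index : Vertex → ℕ
  index centre = 0
  index (hub p) = suc p
  index (pendant p) = suc (N ℕ.+ p)

  label : Vertex → ℕ
  label x = suc (index x)

  next : ℕ → ℕ
  next p = if suc p ≡ᵇ N then 0 else suc p

  prev : ℕ → ℕ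
  prev zero = K
  prev (suc p) = p

  cycleDist : ℕ → ℕ → ℕ
  cycleDist p q = if p ≡ᵇ q then 0 else (if (q ≡ᵇ next p) ∨ (p ≡ᵇ next q) then 1 else 2)

  dist : Vertex → Vertex → ℕ
  dist centre centre = 0
  dist centre (hub _) = 1
  dist centre (pendant _) = 2
  dist (hub _) centre = 1
  dist (pendant _) centre = 2
  dist (hub p) (hub q) = cycleDist p q
  dist (hub p) (pendant q) = suc (cycleDist p q)
  dist (pendant p) (hub q) = suc (cycleDist p q)
  dist (pendant p) (pendant q) = cycleDist p q ℕ.+ (if p ≡ᵇ q then 0 else 2)

  next-< : ∀ p → suc p < N → next p ≡ suc p
  next-< p lt = cong (λ b → if b then 0 else suc p) (≢⇒≡ᵇ-false (suc p) N (ℕP.<⇒≢ lt))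

  next-last : next K ≡ 0
  next-last = cong (λ b → if b then 0 else suc K) (≡ᵇ-refl (suc K))

  next-view : ∀ p → p < N → ((suc p < N) × (next p ≡ suc p)) ⊎ ((p ≡ K) × (next p ≡ 0))
  next-view p lt with suc p ℕP.≟ N
  ... | yes e = inj₂ (ℕP.suc-injective e , subst (λ x → next x ≡ 0) (sym (ℕP.suc-injective e)) next-last)
  ... | no ne = inj₁ (ℕP.≤∧≢⇒< lt ne , next-< p (ℕP.≤∧≢⇒< lt ne))

  next<N : ∀ p → p < N → next p < N
  next<N p lt with next-view p lt
  ... | inj₁ (l , e) = subst (_< N) (sym e) l
  ... | inj₂ (_ , e) = subst (_< N) (sym e) (s≤s z≤n)

  next≢ : ∀ p → p < N → ¬ (p ≡ next p)
  next≢ p lt e with next-view p lt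
  ... | inj₁ (l , e2) = ℕP.1+n≢n (sym (trans e e2))
  ... | inj₂ (e1 , e2) with trans (sym e1) (trans e e2)
  ... | ()

  prev<N : ∀ p → p < N → prev p < N
  prev<N zero l = ℕP.n<1+n K
  prev<N (suc p) l = ℕP.<⇒≤ l

  next-prev : ∀ p → p < N → next (prev p) ≡ p
  next-prev zero l = next-last
  next-prev (suc p) l = next-< p l

  prev-next : ∀ p → p < N → prev (next p) ≡ p
  prev-next p l with next-view p l
  ... | inj₁ (_ , e) = cong prev e
  ... | inj₂ (e1 , e2) = trans (cong prev e2) (sym e1)

  prev≢ : ∀ p → p < N → ¬ prev p ≡ p
  prev≢ zero l ()
  prev≢ (suc p) l e = ℕP.1+n≢n (sym e)

  next²≢ : ∀ p → p < N → ¬ next (next p) ≡ p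
  next²≢ p lp e with next-view p lp
  ... | inj₂ (e1 , e2) with trans (sym (next-< 0 (s≤s (s≤s z≤n)))) (trans (cong next (sym e2)) (trans e e1))
  ... | ()
  next²≢ p lp e | inj₁ (l , e1) with next-view (suc p) l
  ... | inj₁ (l2 , e2) = ℕP.m+1+n≢n 1 (trans (sym e2) (trans (cong next (sym e1)) e))
  ... | inj₂ (e2 , e3) with trans (sym e3) (trans (cong next (sym e1)) e)
  ... | refl with e2
  ... | ()

  next≢prev : ∀ p → p < N → ¬ next p ≡ prev p
  next≢prev p lp e = next²≢ p lp (trans (cong next e) (next-prev p lp))

  CycleDistView : ℕ → ℕ → Set
  CycleDistView p q = ((p ≡ q) × (cycleDist p q ≡ 0))
    ⊎ ((¬ p ≡ q) × ((q ≡ next p) ⊎ (p ≡ next q)) × (cycleDist p q ≡ 1))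
    ⊎ ((¬ p ≡ q) × (¬ q ≡ next p) × (¬ p ≡ next q) × (cycleDist p q ≡ 2))

  cycleDist-view : ∀ p q → CycleDistView p q
  cycleDist-view p q with p ℕP.≟ q
  ... | yes e = inj₁ (e , if-true 0 _ (≡⇒≡ᵇ-true e))
  ... | no ne with q ℕP.≟ next p | p ℕP.≟ next q
  ... | yes e1 | _ = inj₂ (inj₁ (ne , inj₁ e1 , trans (if-false 0 _ (≢⇒≡ᵇ-false p q ne))
          (if-true 1 2 (∨-introˡ (≡⇒≡ᵇ-true e1)))))
  ... | no _ | yes e2 = inj₂ (inj₁ (ne , inj₂ e2 , trans (if-false 0 _ (≢⇒≡ᵇ-false p q ne))
          (if-true 1 2 (∨-introʳ (≡⇒≡ᵇ-true e2)))))
  ... | no n1 | no n2 = inj₂ (inj₂ (ne , n1 , n2 , trans (if-false 0 _ (≢⇒≡ᵇ-false p q ne))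
          (if-false 1 2 (∨-false (≢⇒≡ᵇ-false q (next p) n1) (≢⇒≡ᵇ-false p (next q) n2)))))

  cycleDist-refl : ∀ p → cycleDist p p ≡ 0
  cycleDist-refl p = if-true 0 _ (≡ᵇ-refl p)

  cycleDist-sym : ∀ p q → cycleDist p q ≡ cycleDist q p
  cycleDist-sym p q = cong₂ (λ b d → if b then 0 else (if d then 1 else 2)) (≡ᵇ-sym p q) (BoolP.∨-comm (q ≡ᵇ next p) (p ≡ᵇ next q))

  cycleDist≤2 : ∀ p q → cycleDist p q ≤ 2
  cycleDist≤2 p q with cycleDist-view p q
  ... | inj₁ (_ , e) = subst (_≤ 2) (sym e) z≤n
  ... | inj₂ (inj₁ (_ , _ , e)) = subst (_≤ 2) (sym e) (s≤s z≤n)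
  ... | inj₂ (inj₂ (_ , _ , _ , e)) = subst (_≤ 2) (sym e) ℕP.≤-refl

  cycleDist-pos : ∀ p q → ¬ p ≡ q → 1 ≤ cycleDist p q
  cycleDist-pos p q ne with cycleDist-view p q
  ... | inj₁ (e , _) = ⊥-elim (ne e)
  ... | inj₂ (inj₁ (_ , _ , e)) = subst (1 ≤_) (sym e) ℕP.≤-refl
  ... | inj₂ (inj₂ (_ , _ , _ , e)) = subst (1 ≤_) (sym e) (s≤s z≤n)

  cycleDist-adjacent : ∀ p q → p < N → q < N → ((q ≡ next p) ⊎ (p ≡ next q)) → cycleDist p q ≡ 1
  cycleDist-adjacent p q lp lq ad with cycleDist-view p q
  ... | inj₁ (e , _) with ad
  ... | inj₁ e2 = ⊥-elim (next≢ p lp (trans e e2))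
  ... | inj₂ e2 = ⊥-elim (next≢ q lq (trans (sym e) e2))
  cycleDist-adjacent p q lp lq ad | inj₂ (inj₁ (_ , _ , e)) = e
  cycleDist-adjacent p q lp lq (inj₁ e2) | inj₂ (inj₂ (_ , n1 , n2 , e)) = ⊥-elim (n1 e2)
  cycleDist-adjacent p q lp lq (inj₂ e2) | inj₂ (inj₂ (_ , n1 , n2 , e)) = ⊥-elim (n2 e2)

  cycleDist-step : ∀ p r s → r < N → s < N → ((s ≡ next r) ⊎ (r ≡ next s)) → cycleDist p s ≤ suc (cycleDist p r)
  cycleDist-step p r s lr ls ad with p ℕP.≟ r
  ... | yes refl = subst (λ x → x ≤ suc (cycleDist p p)) (sym (cycleDist-adjacent p s lr ls ad)) (subst (λ x → 1 ≤ suc x) (sym (cycleDist-refl p)) ℕP.≤-refl)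
  ... | no ne = ℕP.≤-trans (cycleDist≤2 p s) (s≤s (cycleDist-pos p r ne))

  data HelmEdge (a b : ℕ) : Set where
    spoke : a ≡ 1 → 2 ≤ b → b ≤ n → HelmEdge a b
    rim : 2 ≤ a → a ≤ N → b ≡ suc a → HelmEdge a b
    rimWrap : a ≡ n → b ≡ 2 → HelmEdge a b
    pendantEdge : 2 ≤ a → a ≤ n → b ≡ N ℕ.+ a → HelmEdge a b

  helmEdge-sound : ∀ a b → helmEdge n a b ≡ true → HelmEdge a b
  helmEdge-sound a b e with ∨-elim {(a ≡ᵇ 1) ∧ inRange 2 n b} e
  ... | inj₁ e1 with ∧-elim {a ≡ᵇ 1} e1
  ... | (x1 , x2) with ∧-elim {2 ≤ᵇ b} x2
  ... | (y1 , y2) = spoke (≡ᵇ-true⇒≡ a 1 x1) (≤ᵇ-true⇒≤ 2 b y1) (≤ᵇ-true⇒≤ b n y2)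
  helmEdge-sound a b e | inj₂ e1 with ∨-elim {inRange 2 (n ∸ 1) a ∧ (b ≡ᵇ suc a)} e1
  ... | inj₁ e2 with ∧-elim {inRange 2 (n ∸ 1) a} e2
  ... | (x1 , x2) with ∧-elim {2 ≤ᵇ a} x1
  ... | (y1 , y2) = rim (≤ᵇ-true⇒≤ 2 a y1) (≤ᵇ-true⇒≤ a N y2) (≡ᵇ-true⇒≡ b (suc a) x2)
  helmEdge-sound a b e | inj₂ e1 | inj₂ e2 with ∨-elim {(a ≡ᵇ n) ∧ (b ≡ᵇ 2)} e2
  ... | inj₁ e3 with ∧-elim {a ≡ᵇ n} e3
  ... | (x1 , x2) = rimWrap (≡ᵇ-true⇒≡ a n x1) (≡ᵇ-true⇒≡ b 2 x2)
  helmEdge-sound a b e | inj₂ e1 | inj₂ e2 | inj₂ e3 with ∧-elim {inRange 2 n a} e3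
  ... | (x1 , x2) with ∧-elim {2 ≤ᵇ a} x1
  ... | (y1 , y2) = pendantEdge (≤ᵇ-true⇒≤ 2 a y1) (≤ᵇ-true⇒≤ a n y2) (≡ᵇ-true⇒≡ b (N ℕ.+ a) x2)

  helmEdge-complete : ∀ {a b} → HelmEdge a b → helmEdge n a b ≡ true
  helmEdge-complete {a} {b} (spoke refl l1 l2) = ∨-introˡ (∧-intro (≤⇒≤ᵇ-true l1) (≤⇒≤ᵇ-true l2))
  helmEdge-complete {a} {b} (rim l1 l2 refl) =
    ∨-introʳ {(a ≡ᵇ 1) ∧ inRange 2 n b}
      (∨-introˡ {y = ((a ≡ᵇ n) ∧ (b ≡ᵇ 2)) ∨ (inRange 2 n a ∧ (b ≡ᵇ n ℕ.+ a ∸ 1))}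
        (∧-intro (∧-intro (≤⇒≤ᵇ-true l1) (≤⇒≤ᵇ-true l2)) (≡ᵇ-refl (suc a))))
  helmEdge-complete {a} {b} (rimWrap refl refl) =
    ∨-introʳ {(a ≡ᵇ 1) ∧ inRange 2 n b} (∨-introʳ {inRange 2 (n ∸ 1) a ∧ (b ≡ᵇ suc a)}
      (∨-introˡ {y = inRange 2 n a ∧ (b ≡ᵇ n ℕ.+ a ∸ 1)} (∧-intro (≡ᵇ-refl n) refl)))
  helmEdge-complete {a} {b} (pendantEdge l1 l2 refl) =
    ∨-introʳ {(a ≡ᵇ 1) ∧ inRange 2 n b} (∨-introʳ {inRange 2 (n ∸ 1) a ∧ (b ≡ᵇ suc a)}
      (∨-introʳ {(a ≡ᵇ n) ∧ (b ≡ᵇ 2)} (∧-intro (∧-intro (≤⇒≤ᵇ-true l1) (≤⇒≤ᵇ-true l2)) (≡ᵇ-refl (N ℕ.+ a)))))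

  data Adjacent : Vertex → Vertex → Set where
    centre-hub : ∀ {q} → Adjacent centre (hub q)
    hub-centre : ∀ {q} → Adjacent (hub q) centre
    hub-next : ∀ {p} → Adjacent (hub p) (hub (next p))
    next-hub : ∀ {p} → Adjacent (hub (next p)) (hub p)
    hub-pendant : ∀ {p} → Adjacent (hub p) (pendant p)
    pendant-hub : ∀ {p} → Adjacent (pendant p) (hub p)

  Adjacent-sym : ∀ {x y} → Adjacent x y → Adjacent y x
  Adjacent-sym centre-hub = hub-centre
  Adjacent-sym hub-centre = centre-hub
  Adjacent-sym hub-next = next-hub
  Adjacent-sym next-hub = hub-next
  Adjacent-sym hub-pendant = pendant-hub
  Adjacent-sym pendant-hub = hub-pendant

  pendantLabel≰1+N : ∀ p → ¬ (suc (suc (N ℕ.+ p)) ≤ suc N)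
  pendantLabel≰1+N p le = ℕP.<-irrefl refl (ℕP.≤-trans (s≤s (ℕP.m≤m+n N p)) (ℕP.≤-pred le))

  pendantLabel≰N : ∀ p → ¬ (suc (suc (N ℕ.+ p)) ≤ N)
  pendantLabel≰N p le = pendantLabel≰1+N p (ℕP.≤-trans le (ℕP.n≤1+n N))

  pendantLabel≢1+N : ∀ p → ¬ (suc (suc (N ℕ.+ p)) ≡ suc N)
  pendantLabel≢1+N p e = pendantLabel≰1+N p (ℕP.≤-reflexive e)

  <N⇒≢N+ : ∀ q r → q < N → ¬ (q ≡ N ℕ.+ r)
  <N⇒≢N+ q r lt e = ℕP.<-irrefl refl (ℕP.≤-trans lt (subst (N ≤_) (sym e) (ℕP.m≤m+n N r)))

  +-suc² : ∀ p → N ℕ.+ suc (suc p) ≡ suc (suc (N ℕ.+ p))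
  +-suc² p = trans (ℕP.+-suc N (suc p)) (cong suc (ℕP.+-suc N p))

  helmEdge⇒Adjacent : ∀ z y → IsVertex z → IsVertex y → HelmEdge (label z) (label y) → Adjacent z y
  helmEdge⇒Adjacent centre centre vz vy (spoke _ (s≤s ()) _)
  helmEdge⇒Adjacent centre centre vz vy (rim (s≤s ()) _ _)
  helmEdge⇒Adjacent centre centre vz vy (rimWrap () _)
  helmEdge⇒Adjacent centre centre vz vy (pendantEdge (s≤s ()) _ _)
  helmEdge⇒Adjacent centre (hub q) vz vy _ = centre-hub
  helmEdge⇒Adjacent centre (pendant q) vz vy (spoke _ _ l) = ⊥-elim (pendantLabel≰1+N q l)
  helmEdge⇒Adjacent centre (pendant q) vz vy (rim (s≤s ()) _ _)
  helmEdge⇒Adjacent centre (pendant q) vz vy (rimWrap () _)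
  helmEdge⇒Adjacent centre (pendant q) vz vy (pendantEdge (s≤s ()) _ _)
  helmEdge⇒Adjacent (hub p) centre vz vy (spoke () _ _)
  helmEdge⇒Adjacent (hub p) centre vz vy (rim _ _ ())
  helmEdge⇒Adjacent (hub p) centre vz vy (rimWrap _ ())
  helmEdge⇒Adjacent (hub p) centre vz vy (pendantEdge _ _ e) = ⊥-elim (ℕP.0≢1+n (ℕP.suc-injective (trans e (+-suc² p))))
  helmEdge⇒Adjacent (hub p) (hub q) vz vy (spoke () _ _)
  helmEdge⇒Adjacent (hub p) (hub q) vz vy (rim _ l2 e) =
    subst (λ x → Adjacent (hub p) (hub x)) (trans (next-< p l2) (sym (ℕP.suc-injective (ℕP.suc-injective e)))) hub-next
  helmEdge⇒Adjacent (hub p) (hub q) vz vy (rimWrap e1 e2) =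
    subst₂ (λ x y → Adjacent (hub x) (hub y)) (sym (ℕP.suc-injective (ℕP.suc-injective e1)))
      (trans next-last (sym (ℕP.suc-injective (ℕP.suc-injective e2)))) (hub-next {K})
  helmEdge⇒Adjacent (hub p) (hub q) vz vy (pendantEdge _ _ e) = ⊥-elim (<N⇒≢N+ q p vy (ℕP.suc-injective (ℕP.suc-injective (trans e (+-suc² p)))))
  helmEdge⇒Adjacent (hub p) (pendant q) vz vy (spoke () _ _)
  helmEdge⇒Adjacent (hub p) (pendant q) vz vy (rim _ l2 e) = ⊥-elim (<N⇒≢N+ (suc p) q l2 (sym (ℕP.suc-injective (ℕP.suc-injective e))))
  helmEdge⇒Adjacent (hub p) (pendant q) vz vy (rimWrap _ ())
  helmEdge⇒Adjacent (hub p) (pendant q) vz vy (pendantEdge _ _ e) =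
    subst (λ x → Adjacent (hub p) (pendant x)) (sym (ℕP.+-cancelˡ-≡ N q p (ℕP.suc-injective (ℕP.suc-injective (trans e (+-suc² p)))))) hub-pendant
  helmEdge⇒Adjacent (pendant p) y vz vy (spoke () _ _)
  helmEdge⇒Adjacent (pendant p) y vz vy (rim _ l2 _) = ⊥-elim (pendantLabel≰N p l2)
  helmEdge⇒Adjacent (pendant p) y vz vy (rimWrap e _) = ⊥-elim (pendantLabel≢1+N p e)
  helmEdge⇒Adjacent (pendant p) y vz vy (pendantEdge _ l2 _) = ⊥-elim (pendantLabel≰1+N p l2)

  helmAdj⇒Adjacent : ∀ z y → IsVertex z → IsVertex y → helmAdjℕ n (label z) (label y) ≡ true → Adjacent z y
  helmAdj⇒Adjacent z y vz vy e with ∨-elim {helmEdge n (label z) (label y)} e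
  ... | inj₁ e1 = helmEdge⇒Adjacent z y vz vy (helmEdge-sound _ _ e1)
  ... | inj₂ e2 = Adjacent-sym (helmEdge⇒Adjacent y z vy vz (helmEdge-sound _ _ e2))

  Adjacent⇒helmEdge : ∀ z y → IsVertex z → IsVertex y → Adjacent z y → helmEdge n (label z) (label y) ≡ true ⊎ helmEdge n (label y) (label z) ≡ true
  Adjacent⇒helmEdge centre (hub q) vz vy centre-hub = inj₁ (helmEdge-complete (spoke refl (s≤s (s≤s z≤n)) (s≤s vy)))
  Adjacent⇒helmEdge (hub q) centre vz vy hub-centre = inj₂ (helmEdge-complete (spoke refl (s≤s (s≤s z≤n)) (s≤s vz)))
  Adjacent⇒helmEdge (hub p) (hub _) vz vy hub-next with next-view p vz
  ... | inj₁ (l , e) = inj₁ (helmEdge-complete (rim (s≤s (s≤s z≤n)) l (cong (λ x → suc (suc x)) e)))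
  ... | inj₂ (e1 , e2) = inj₁ (helmEdge-complete (rimWrap (cong (λ x → suc (suc x)) e1) (cong (λ x → suc (suc x)) e2)))
  Adjacent⇒helmEdge (hub _) (hub p) vz vy next-hub with Adjacent⇒helmEdge (hub p) (hub (next p)) vy vz hub-next
  ... | inj₁ x = inj₂ x
  ... | inj₂ x = inj₁ x
  Adjacent⇒helmEdge (hub p) (pendant p) vz vy hub-pendant = inj₁ (helmEdge-complete (pendantEdge (s≤s (s≤s z≤n)) (s≤s vz) (sym (+-suc² p))))
  Adjacent⇒helmEdge (pendant p) (hub p) vz vy pendant-hub = inj₂ (helmEdge-complete (pendantEdge (s≤s (s≤s z≤n)) (s≤s vy) (sym (+-suc² p))))

  Adjacent⇒helmAdj : ∀ z y → IsVertex z → IsVertex y → Adjacent z y → helmAdjℕ n (label z) (label y) ≡ true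
  Adjacent⇒helmAdj z y vz vy a with Adjacent⇒helmEdge z y vz vy a
  ... | inj₁ e = ∨-introˡ e
  ... | inj₂ e = ∨-introʳ {helmEdge n (label z) (label y)} e

  if0else2≤2 : ∀ b → (if b then 0 else 2) ≤ 2
  if0else2≤2 true = z≤n
  if0else2≤2 false = ℕP.≤-refl

  dist-step : ∀ x z y → IsVertex x → IsVertex z → IsVertex y → Adjacent z y → dist x y ≤ suc (dist x z)
  dist-step centre _ _ vx vz vy centre-hub = s≤s z≤n
  dist-step centre _ _ vx vz vy hub-centre = z≤n
  dist-step centre _ _ vx vz vy hub-next = s≤s z≤n
  dist-step centre _ _ vx vz vy next-hub = s≤s z≤n
  dist-step centre _ _ vx vz vy hub-pendant = ℕP.≤-refl
  dist-step centre _ _ vx vz vy pendant-hub = s≤s z≤n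
  dist-step (hub p) _ (hub q) vx vz vy centre-hub = cycleDist≤2 p q
  dist-step (hub p) _ _ vx vz vy hub-centre = s≤s z≤n
  dist-step (hub p) (hub r) _ vx vz vy hub-next = cycleDist-step p r (next r) vz vy (inj₁ refl)
  dist-step (hub p) _ (hub r) vx vz vy next-hub = cycleDist-step p (next r) r vz vy (inj₂ refl)
  dist-step (hub p) _ _ vx vz vy hub-pendant = ℕP.≤-refl
  dist-step (hub p) _ _ vx vz vy pendant-hub = ℕP.≤-trans (ℕP.n≤1+n _) (ℕP.n≤1+n _)
  dist-step (pendant p) _ (hub q) vx vz vy centre-hub = s≤s (cycleDist≤2 p q)
  dist-step (pendant p) _ _ vx vz vy hub-centre = s≤s (s≤s z≤n)
  dist-step (pendant p) (hub r) _ vx vz vy hub-next = s≤s (cycleDist-step p r (next r) vz vy (inj₁ refl))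
  dist-step (pendant p) _ (hub r) vx vz vy next-hub = s≤s (cycleDist-step p (next r) r vz vy (inj₂ refl))
  dist-step (pendant p) (hub r) _ vx vz vy hub-pendant =
    subst (λ x → cycleDist p r ℕ.+ (if p ≡ᵇ r then 0 else 2) ≤ x) (ℕP.+-comm (cycleDist p r) 2)
      (ℕP.+-monoʳ-≤ (cycleDist p r) (if0else2≤2 (p ≡ᵇ r)))
  dist-step (pendant p) (pendant r) _ vx vz vy pendant-hub = s≤s (ℕP.m≤m+n _ _)

  dist-refl : ∀ x → dist x x ≡ 0
  dist-refl centre = refl
  dist-refl (hub p) = cycleDist-refl p
  dist-refl (pendant p) = cong₂ ℕ._+_ (cycleDist-refl p) (if-true 0 2 (≡ᵇ-refl p))

  dist-sym : ∀ x y → dist x y ≡ dist y x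
  dist-sym centre centre = refl
  dist-sym centre (hub _) = refl
  dist-sym centre (pendant _) = refl
  dist-sym (hub _) centre = refl
  dist-sym (pendant _) centre = refl
  dist-sym (hub p) (hub q) = cycleDist-sym p q
  dist-sym (hub p) (pendant q) = cong suc (cycleDist-sym p q)
  dist-sym (pendant p) (hub q) = cong suc (cycleDist-sym p q)
  dist-sym (pendant p) (pendant q) = cong₂ ℕ._+_ (cycleDist-sym p q) (cong (λ b → if b then 0 else 2) (≡ᵇ-sym p q))

  dist-predecessor : ∀ x y t → IsVertex x → IsVertex y → dist x y ≡ suc t → Σ Vertex (λ z → IsVertex z × Adjacent z y × dist x z ≡ t)
  dist-predecessor centre centre t vx vy ()
  dist-predecessor centre (hub q) .0 vx vy refl = centre , tt , centre-hub , refl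
  dist-predecessor centre (pendant q) .1 vx vy refl = hub q , vy , hub-pendant , refl
  dist-predecessor (hub p) centre .0 vx vy refl = hub p , vx , hub-centre , cycleDist-refl p
  dist-predecessor (hub p) (hub q) t vx vy e with cycleDist-view p q
  ... | inj₁ (_ , e0) = ⊥-elim (ℕP.0≢1+n (trans (sym e0) e))
  ... | inj₂ (inj₁ (ne , inj₁ qs , e1)) =
    hub p , vx , subst (λ x → Adjacent (hub p) (hub x)) (sym qs) hub-next , trans (cycleDist-refl p) (ℕP.suc-injective (trans (sym e1) e))
  ... | inj₂ (inj₁ (ne , inj₂ ps , e1)) =
    hub p , vx , subst (λ x → Adjacent (hub x) (hub q)) (sym ps) next-hub , trans (cycleDist-refl p) (ℕP.suc-injective (trans (sym e1) e))
  ... | inj₂ (inj₂ (_ , _ , _ , e2)) = centre , tt , centre-hub , ℕP.suc-injective (trans (sym e2) e)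
  dist-predecessor (hub p) (pendant q) t vx vy e = hub q , vy , hub-pendant , ℕP.suc-injective e
  dist-predecessor (pendant p) centre .1 vx vy refl = hub p , vx , hub-centre , cong suc (cycleDist-refl p)
  dist-predecessor (pendant p) (hub q) t vx vy e with cycleDist-view p q
  ... | inj₁ (refl , e0) = pendant p , vx , pendant-hub , trans (dist-refl (pendant p)) (ℕP.suc-injective (trans (cong suc (sym e0)) e))
  ... | inj₂ (inj₁ (ne , inj₁ qs , e1)) =
    hub p , vx , subst (λ x → Adjacent (hub p) (hub x)) (sym qs) hub-next , trans (cong suc (cycleDist-refl p)) (trans (sym e1) (ℕP.suc-injective e))
  ... | inj₂ (inj₁ (ne , inj₂ ps , e1)) =
    hub p , vx , subst (λ x → Adjacent (hub x) (hub q)) (sym ps) next-hub , trans (cong suc (cycleDist-refl p)) (trans (sym e1) (ℕP.suc-injective e))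
  ... | inj₂ (inj₂ (_ , _ , _ , e2)) = centre , tt , centre-hub , trans (sym e2) (ℕP.suc-injective e)
  dist-predecessor (pendant p) (pendant q) t vx vy e with p ℕP.≟ q
  ... | yes refl = ⊥-elim (ℕP.0≢1+n (trans (sym (dist-refl (pendant p))) e))
  ... | no ne = hub q , vy , hub-pendant , ℕP.suc-injective (trans (sym (trans (cong (cycleDist p q ℕ.+_) (if-false 0 2 (≢⇒≡ᵇ-false p q ne))) (ℕP.+-comm (cycleDist p q) 2))) e)

  m : ℕ
  m = helmOrder n

  m≡1+N+N : m ≡ suc (N ℕ.+ N)
  m≡1+N+N = trans (ℕP.+-suc N (N ℕ.+ 0)) (cong (λ x → suc (N ℕ.+ x)) (ℕP.+-identityʳ N))

  index-surjective : ∀ t → t < suc (N ℕ.+ N) → Σ Vertex (λ x → IsVertex x × (t ≡ index x))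
  index-surjective zero lt = centre , tt , refl
  index-surjective (suc t) lt with t ℕP.<? N
  ... | yes l = hub t , l , refl
  ... | no nl = pendant (t ∸ N) , ℕP.+-cancelˡ-<  N _ _ (subst (_< N ℕ.+ N) (sym (ℕP.m+[n∸m]≡n (ℕP.≮⇒≥ nl))) (ℕP.≤-pred lt))
              , cong suc (sym (ℕP.m+[n∸m]≡n (ℕP.≮⇒≥ nl)))

  vertexOfFin : ∀ (i : Fin m) → Σ Vertex (λ x → IsVertex x × (toℕ i ≡ index x))
  vertexOfFin i = index-surjective (toℕ i) (subst (toℕ i <_) m≡1+N+N (FP.toℕ<n i))

  index<m : ∀ x → IsVertex x → index x < m
  index<m x v = subst (index x <_) (sym m≡1+N+N) (go x v)
    where
    go : ∀ x → IsVertex x → index x < suc (N ℕ.+ N)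
    go centre v = s≤s z≤n
    go (hub p) v = s≤s (ℕP.≤-trans v (ℕP.m≤m+n N N))
    go (pendant p) v = s≤s (ℕP.+-monoʳ-< N v)

  toFin : ∀ x → IsVertex x → Fin m
  toFin x v = fromℕ< (index<m x v)

  toℕ-toFin : ∀ x v → toℕ (toFin x v) ≡ index x
  toℕ-toFin x v = FP.toℕ-fromℕ< (index<m x v)

  vertexAt : ℕ → Vertex
  vertexAt zero = centre
  vertexAt (suc t) = if suc t ≤ᵇ N then hub t else pendant (t ∸ N)

  vertexAt-index : ∀ x → IsVertex x → vertexAt (index x) ≡ x
  vertexAt-index centre v = refl
  vertexAt-index (hub p) v = if-true (hub p) _ (≤⇒≤ᵇ-true v)
  vertexAt-index (pendant p) v = trans (if-false _ _ (>⇒≤ᵇ-false (s≤s (ℕP.m≤m+n N p)))) (cong pendant (ℕP.m+n∸m≡n N p))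

  distFin : Fin m → Fin m → ℕ
  distFin i j = dist (vertexAt (toℕ i)) (vertexAt (toℕ j))

  distFin≡dist : ∀ {i j : Fin m} {x y} → IsVertex x → IsVertex y → toℕ i ≡ index x → toℕ j ≡ index y → distFin i j ≡ dist x y
  distFin≡dist {i} {j} {x} {y} vx vy ei ej = cong₂ dist (trans (cong vertexAt ei) (vertexAt-index x vx)) (trans (cong vertexAt ej) (vertexAt-index y vy))

  dist≡0⇒≡ : ∀ x y → IsVertex x → IsVertex y → dist x y ≡ 0 → x ≡ y
  dist≡0⇒≡ centre centre _ _ _ = refl
  dist≡0⇒≡ centre (hub _) _ _ ()
  dist≡0⇒≡ centre (pendant _) _ _ ()
  dist≡0⇒≡ (hub _) centre _ _ ()
  dist≡0⇒≡ (pendant _) centre _ _ ()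
  dist≡0⇒≡ (hub p) (pendant _) _ _ ()
  dist≡0⇒≡ (pendant p) (hub _) _ _ ()
  dist≡0⇒≡ (hub p) (hub q) _ _ e with cycleDist-view p q
  ... | inj₁ (e1 , _) = cong hub e1
  ... | inj₂ (inj₁ (_ , _ , e1)) = ⊥-elim (ℕP.0≢1+n (trans (sym e) e1))
  ... | inj₂ (inj₂ (_ , _ , _ , e1)) = ⊥-elim (ℕP.0≢1+n (trans (sym e) e1))
  dist≡0⇒≡ (pendant p) (pendant q) _ _ e with p ℕP.≟ q
  ... | yes e1 = cong pendant e1
  ... | no ne = ⊥-elim (ℕP.0≢1+n (trans (sym e) (trans (cong (cycleDist p q ℕ.+_) (if-false 0 2 (≢⇒≡ᵇ-false p q ne))) (ℕP.+-comm (cycleDist p q) 2))))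

  index-injective : ∀ x y → IsVertex x → IsVertex y → index x ≡ index y → x ≡ y
  index-injective centre centre _ _ _ = refl
  index-injective centre (hub _) _ _ ()
  index-injective centre (pendant _) _ _ ()
  index-injective (hub _) centre _ _ ()
  index-injective (pendant _) centre _ _ ()
  index-injective (hub p) (hub q) _ _ e = cong hub (ℕP.suc-injective e)
  index-injective (hub p) (pendant q) vx _ e = ⊥-elim (<N⇒≢N+ p q vx (ℕP.suc-injective e))
  index-injective (pendant p) (hub q) _ vy e = ⊥-elim (<N⇒≢N+ q p vy (sym (ℕP.suc-injective e)))
  index-injective (pendant p) (pendant q) _ _ e = cong pendant (ℕP.+-cancelˡ-≡ N p q (ℕP.suc-injective e))

  -- dist is the breadth-first distance: it vanishes only on the diagonal, grows by at most one
  -- along an edge (dist-step), and a vertex at distance t + 1 has a neighbour at distance t.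
  reachWithin≡distFin≤ᵇ : ∀ t (i j : Fin m) → reachWithin (helmAdj n) t i j ≡ (distFin i j ≤ᵇ t)
  reachWithin≡distFin≤ᵇ zero i j with vertexOfFin i | vertexOfFin j
  ... | (x , vx , ei) | (y , vy , ej) = ≡true-ext f g
    where
    f : (toℕ i ≡ᵇ toℕ j) ≡ true → (distFin i j ≤ᵇ 0) ≡ true
    f e = ≤⇒≤ᵇ-true {distFin i j} {0} (ℕP.≤-reflexive (trans (distFin≡dist vx vy ei ej)
            (trans (cong (dist x) (sym (index-injective x y vx vy (trans (sym ei) (trans (≡ᵇ-true⇒≡ _ _ e) ej))))) (dist-refl x))))
    g : (distFin i j ≤ᵇ 0) ≡ true → (toℕ i ≡ᵇ toℕ j) ≡ true
    g e = ≡⇒≡ᵇ-true (trans (trans ei (cong index (dist≡0⇒≡ x y vx vy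
            (ℕP.n≤0⇒n≡0 (subst (_≤ 0) (distFin≡dist vx vy ei ej) (≤ᵇ-true⇒≤ _ 0 e)))))) (sym ej))
  reachWithin≡distFin≤ᵇ (suc t) i j =
    trans (cong₂ _∨_ (reachWithin≡distFin≤ᵇ t i j) (anyFin-cong _ _ (λ l → cong (_∧ helmAdj n l j) (reachWithin≡distFin≤ᵇ t i l))))
      (≡true-ext f g)
    where
    vi = vertexOfFin i
    vj = vertexOfFin j
    x = proj₁ vi
    y = proj₁ vj
    vx = proj₁ (proj₂ vi)
    vy = proj₁ (proj₂ vj)
    ei = proj₂ (proj₂ vi)
    ej = proj₂ (proj₂ vj)
    f : ((distFin i j ≤ᵇ t) ∨ anyFin (λ l → (distFin i l ≤ᵇ t) ∧ helmAdj n l j)) ≡ true → (distFin i j ≤ᵇ suc t) ≡ true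
    f e with ∨-elim {distFin i j ≤ᵇ t} e
    ... | inj₁ e1 = ≤⇒≤ᵇ-true {distFin i j} {suc t} (ℕP.m≤n⇒m≤1+n (≤ᵇ-true⇒≤ _ t e1))
    ... | inj₂ e2 with anyFin-elim (λ l → (distFin i l ≤ᵇ t) ∧ helmAdj n l j) e2
    ... | (l , el) with ∧-elim {distFin i l ≤ᵇ t} el | vertexOfFin l
    ... | (d1 , a1′) | (z , vz , ez) =
      ≤⇒≤ᵇ-true {distFin i j} {suc t} (subst (_≤ suc t) (sym (distFin≡dist vx vy ei ej))
        (ℕP.≤-trans (dist-step x z y vx vz vy
           (helmAdj⇒Adjacent z y vz vy (subst₂ (λ u w → helmAdjℕ n (suc u) (suc w) ≡ true) ez ej a1′)))
          (s≤s (subst (_≤ t) (distFin≡dist vx vz ei ez) (≤ᵇ-true⇒≤ _ t d1)))))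
    g : (distFin i j ≤ᵇ suc t) ≡ true → ((distFin i j ≤ᵇ t) ∨ anyFin (λ l → (distFin i l ≤ᵇ t) ∧ helmAdj n l j)) ≡ true
    g e with distFin i j ℕP.≤? t
    ... | yes le = ∨-introˡ (≤⇒≤ᵇ-true {distFin i j} {t} le)
    ... | no nle with dist-predecessor x y t vx vy
           (trans (sym (distFin≡dist vx vy ei ej)) (ℕP.≤-antisym (≤ᵇ-true⇒≤ _ (suc t) e) (ℕP.≰⇒> nle)))
    ... | (z , vz , az , dz) =
      ∨-introʳ {distFin i j ≤ᵇ t} (anyFin-intro (λ l → (distFin i l ≤ᵇ t) ∧ helmAdj n l j) (toFin z vz)
        (∧-intro (≤⇒≤ᵇ-true {distFin i (toFin z vz)} {t} (ℕP.≤-reflexive (trans (distFin≡dist vx vz ei (toℕ-toFin z vz)) dz)))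
              (subst₂ (λ u w → helmAdjℕ n (suc u) (suc w) ≡ true) (sym (toℕ-toFin z vz)) (sym ej)
                 (Adjacent⇒helmAdj z y vz vy az))))

  dist≤4 : ∀ x y → dist x y ≤ 4
  dist≤4 centre centre = z≤n
  dist≤4 centre (hub _) = s≤s z≤n
  dist≤4 centre (pendant _) = s≤s (s≤s z≤n)
  dist≤4 (hub _) centre = s≤s z≤n
  dist≤4 (pendant _) centre = s≤s (s≤s z≤n)
  dist≤4 (hub p) (hub q) = ℕP.≤-trans (cycleDist≤2 p q) (s≤s (s≤s z≤n))
  dist≤4 (hub p) (pendant q) = s≤s (ℕP.≤-trans (cycleDist≤2 p q) (s≤s (s≤s z≤n)))
  dist≤4 (pendant p) (hub q) = s≤s (ℕP.≤-trans (cycleDist≤2 p q) (s≤s (s≤s z≤n)))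
  dist≤4 (pendant p) (pendant q) = ℕP.+-mono-≤ (cycleDist≤2 p q) (if0else2≤2 (p ≡ᵇ q))

  graphDist≡distFin : ∀ (i j : Fin m) → graphDist (helmAdj n) i j ≡ distFin i j
  graphDist≡distFin i j = trans (least-cong m _ _ (λ t → reachWithin≡distFin≤ᵇ t i j))
    (least-≤ᵇ m (distFin i j) (subst (distFin i j <_) (sym m≡1+N+N)
       (s≤s (ℕP.≤-trans (dist≤4 (vertexAt (toℕ i)) (vertexAt (toℕ j))) (s≤s (s≤s (s≤s (ℕP.≤-trans (s≤s z≤n) (ℕP.m≤n+m N (h ℕ.+ h))))))))))

  -- offset p q ≡ q − p (mod N) is literally the index that Defs.circ reads at (hub p, hub q).
  offset : ℕ → ℕ → ℕ
  offset p q = (q ℕ.+ N ∸ p) % N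

  IsOffset : ℕ → ℕ → ℕ → Set
  IsOffset p q r = (p ℕ.+ r ≡ q) ⊎ (p ℕ.+ r ≡ q ℕ.+ N)

  offset-spec : ∀ p q → p < N → q < N → (offset p q < N) × IsOffset p q (offset p q)
  offset-spec p q lp lq with p ℕP.≤? q
  ... | yes le = subst (_< N) (sym e) (ℕP.≤-<-trans (ℕP.m∸n≤m q p) lq) ,
                 inj₁ (trans (cong (p ℕ.+_) e) (ℕP.m+[n∸m]≡n le))
    where
    e : offset p q ≡ q ∸ p
    e = trans (cong (_% N) (ℕP.+-∸-comm N le)) (trans (ℕD.[m+n]%n≡m%n (q ∸ p) N) (ℕD.m<n⇒m%n≡m (ℕP.≤-<-trans (ℕP.m∸n≤m q p) lq)))
  ... | no nle = subst (_< N) (sym e) r<N , inj₂ (trans (cong (p ℕ.+_) e) e2)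
    where
    le2 : p ≤ q ℕ.+ N
    le2 = ℕP.≤-trans (ℕP.<⇒≤ lp) (ℕP.m≤n+m N q)
    e2 : p ℕ.+ (q ℕ.+ N ∸ p) ≡ q ℕ.+ N
    e2 = ℕP.m+[n∸m]≡n le2
    r<N : q ℕ.+ N ∸ p < N
    r<N = ℕP.+-cancelˡ-< p _ _ (subst (_< p ℕ.+ N) (sym e2) (ℕP.+-monoˡ-< N (ℕP.≰⇒> nle)))
    e : offset p q ≡ q ℕ.+ N ∸ p
    e = ℕD.m<n⇒m%n≡m r<N

  IsOffset-unique : ∀ p q r s → q < N → r < N → s < N → IsOffset p q r → IsOffset p q s → r ≡ s
  IsOffset-unique p q r s lq lr ls (inj₁ e1) (inj₁ e2) = ℕP.+-cancelˡ-≡ p r s (trans e1 (sym e2))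
  IsOffset-unique p q r s lq lr ls (inj₂ e1) (inj₂ e2) = ℕP.+-cancelˡ-≡ p r s (trans e1 (sym e2))
  IsOffset-unique p q r s lq lr ls (inj₁ e1) (inj₂ e2) = ⊥-elim (ℕP.<⇒≱ ls (subst (N ≤_) (sym e4) (ℕP.m≤n+m N r)))
    where
    e3 : p ℕ.+ s ≡ p ℕ.+ (r ℕ.+ N)
    e3 = trans e2 (trans (cong (ℕ._+ N) (sym e1)) (ℕP.+-assoc p r N))
    e4 : s ≡ r ℕ.+ N
    e4 = ℕP.+-cancelˡ-≡ p s (r ℕ.+ N) e3
  IsOffset-unique p q r s lq lr ls (inj₂ e1) (inj₁ e2) = sym (IsOffset-unique p q s r lq ls lr (inj₁ e2) (inj₂ e1))

  <N⇒≢+N : ∀ p q → p < N → ¬ (p ≡ q ℕ.+ N)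
  <N⇒≢+N p q l e = ℕP.<⇒≱ l (subst (N ≤_) (sym e) (ℕP.m≤n+m N q))

  IsOffset-next : ∀ p q r → p < N → q < N → IsOffset p q r → IsOffset (next p) q (prev r)
  IsOffset-next p q r lp lq rs with next-view p lp
  IsOffset-next p q (suc r) lp lq (inj₁ e) | inj₁ (_ , es) = inj₁ (trans (cong (ℕ._+ r) es) (trans (sym (ℕP.+-suc p r)) e))
  IsOffset-next p q (suc r) lp lq (inj₂ e) | inj₁ (_ , es) = inj₂ (trans (cong (ℕ._+ r) es) (trans (sym (ℕP.+-suc p r)) e))
  IsOffset-next p q zero lp lq (inj₁ e) | inj₁ (_ , es) =
    inj₂ (trans (cong (ℕ._+ K) es) (trans (sym (ℕP.+-suc p K)) (cong (ℕ._+ N) (trans (sym (ℕP.+-identityʳ p)) e))))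
  IsOffset-next p q zero lp lq (inj₂ e) | inj₁ (_ , es) = ⊥-elim (<N⇒≢+N p q lp (trans (sym (ℕP.+-identityʳ p)) e))
  IsOffset-next p q (suc r) lp lq (inj₁ e) | inj₂ (ep , es) =
    ⊥-elim (ℕP.<⇒≱ lq (subst (N ≤_) (trans (sym (ℕP.+-suc K r)) (trans (cong (ℕ._+ suc r) (sym ep)) e)) (ℕP.m≤m+n N r)))
  IsOffset-next p q (suc r) lp lq (inj₂ e) | inj₂ (ep , es) =
    inj₁ (trans (cong (ℕ._+ r) es) (ℕP.+-cancelˡ-≡ N r q (trans (sym (ℕP.+-suc K r)) (trans (cong (ℕ._+ suc r) (sym ep)) (trans e (ℕP.+-comm q N))))))
  IsOffset-next p q zero lp lq (inj₁ e) | inj₂ (ep , es) = inj₁ (trans (cong (ℕ._+ K) es) (trans (sym ep) (trans (sym (ℕP.+-identityʳ p)) e)))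
  IsOffset-next p q zero lp lq (inj₂ e) | inj₂ (ep , es) = ⊥-elim (<N⇒≢+N p q lp (trans (sym (ℕP.+-identityʳ p)) e))

  offset<N : ∀ p q → p < N → q < N → offset p q < N
  offset<N p q lp lq = proj₁ (offset-spec p q lp lq)

  offset-next : ∀ p q → p < N → q < N → offset (next p) q ≡ prev (offset p q)
  offset-next p q lp lq = IsOffset-unique (next p) q _ _ lq (offset<N (next p) q (next<N p lp) lq)
    (prev<N _ (offset<N p q lp lq))
    (proj₂ (offset-spec (next p) q (next<N p lp) lq)) (IsOffset-next p q _ lp lq (proj₂ (offset-spec p q lp lq)))

  offset-prev : ∀ p q → p < N → q < N → offset (prev p) q ≡ next (offset p q)
  offset-prev p q lp lq = trans (sym (next-prev _ (offset<N s q ls lq)))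
    (cong next (trans (sym (offset-next s q ls lq)) (cong (λ x → offset x q) (next-prev p lp))))
    where
    s = prev p
    ls = prev<N p lp

  offset≡0⇒≡ : ∀ p q → p < N → q < N → offset p q ≡ 0 → p ≡ q
  offset≡0⇒≡ p q lp lq e with proj₂ (offset-spec p q lp lq)
  ... | inj₁ e1 = trans (sym (ℕP.+-identityʳ p)) (trans (cong (p ℕ.+_) (sym e)) e1)
  ... | inj₂ e1 = ⊥-elim (<N⇒≢+N p q lp (trans (sym (ℕP.+-identityʳ p)) (trans (cong (p ℕ.+_) (sym e)) e1)))

  offset-refl : ∀ p → p < N → offset p p ≡ 0
  offset-refl p lp = IsOffset-unique p p _ 0 lp (offset<N p p lp lp) (s≤s z≤n) (proj₂ (offset-spec p p lp lp)) (inj₁ (ℕP.+-identityʳ p))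

  offset-swap : ∀ p q → p < N → q < N → ¬ p ≡ q → offset q p ≡ N ∸ offset p q
  offset-swap p q lp lq ne = IsOffset-unique q p _ _ lp (offset<N q p lq lp) lt (proj₂ (offset-spec q p lq lp)) rs
    where
    r = offset p q
    r′ = N ∸ r
    r≥1 : 1 ≤ r
    r≥1 = ℕP.n≢0⇒n>0 (λ z → ne (offset≡0⇒≡ p q lp lq z))
    rr′ : r ℕ.+ r′ ≡ N
    rr′ = ℕP.m+[n∸m]≡n (ℕP.<⇒≤ (offset<N p q lp lq))
    lt : r′ < N
    lt = subst (r′ <_) (ℕP.m∸n+n≡m (ℕP.<⇒≤ (offset<N p q lp lq))) (ℕP.m<m+n r′ r≥1)
    rs : IsOffset q p r′
    rs with proj₂ (offset-spec p q lp lq)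
    ... | inj₁ e = inj₂ (trans (cong (ℕ._+ r′) (sym e)) (trans (ℕP.+-assoc p r r′) (cong (p ℕ.+_) rr′)))
    ... | inj₂ e = inj₁ (sym (ℕP.+-cancelʳ-≡ r p (q ℕ.+ r′)
            (trans e (trans (cong (q ℕ.+_) (trans (sym rr′) (ℕP.+-comm r r′))) (sym (ℕP.+-assoc q r′ r))))))

  1+h<K : suc h < K
  1+h<K = s≤s (s≤s (ℕP.m≤m+n h h))

  2+h<N : suc (suc h) < N
  2+h<N = s≤s (s≤s (s≤s (ℕP.m≤m+n h h)))

  -- c^k has its ones at offsets k and N − k; circIndex recovers k from either.
  circIndex : ℕ → ℕ
  circIndex r = if r ≤ᵇ suc h then r else N ∸ r

  circIndex-≤ : ∀ r → r ≤ suc h → circIndex r ≡ r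
  circIndex-≤ r le = if-true r _ (≤⇒≤ᵇ-true le)

  circIndex-> : ∀ r → suc h < r → circIndex r ≡ N ∸ r
  circIndex-> r lt = if-false r _ (>⇒≤ᵇ-false lt)

  circWeight : ℕ → ℚ
  circWeight k = ((ℤ.+ N) ℤ.- (ℤ.+ (2 ℕ.* k))) ℚ./ 2

  circCoeff : ℕ → ℚ
  circCoeff k = signPow k * circWeight k

  Nℚ : ℚ
  Nℚ = fromℕ N

  2ℚ : ℚ
  2ℚ = fromℕ 2

  circCoeff≡ : ∀ k → circCoeff k ≡ signPow k * ((Nℚ - 2ℚ * fromℕ k) * ½)
  circCoeff≡ k = cong (signPow k *_) (trans (/-as-* ((ℤ.+ N) ℤ.- (ℤ.+ (2 ℕ.* k))) 1)
    (cong (_* ½) (trans (fromℤ-sub N (2 ℕ.* k)) (cong (λ z → Nℚ - z) (fromℕ-* 2 k)))))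

  Nℚ≡ : Nℚ ≡ fromℕ 3 + (fromℕ h + fromℕ h)
  Nℚ≡ = trans (fromℕ-+ 3 (h ℕ.+ h)) (cong (fromℕ 3 +_) (fromℕ-+ h h))

  circCoeff-interior : ∀ j → circCoeff j + circCoeff (suc (suc j)) + (circCoeff (suc j) + circCoeff (suc j)) ≡ 0ℚ
  circCoeff-interior j
    rewrite circCoeff≡ j | circCoeff≡ (suc j) | circCoeff≡ (suc (suc j)) | fromℕ-suc (suc j) | fromℕ-suc j
    = solve 3 (λ σ x y →
        σ :* ((x :- con 2ℚ :* y) :* con ½) :+ (:- (:- σ)) :* ((x :- con 2ℚ :* (con 1ℚ :+ (con 1ℚ :+ y))) :* con ½)
        :+ ((:- σ) :* ((x :- con 2ℚ :* (con 1ℚ :+ y)) :* con ½) :+ (:- σ) :* ((x :- con 2ℚ :* (con 1ℚ :+ y)) :* con ½))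
        := con 0ℚ) refl (signPow j) Nℚ (fromℕ j)

  circCoeff-middle : circCoeff h + circCoeff (suc h) + (circCoeff (suc h) + circCoeff (suc h)) ≡ 0ℚ
  circCoeff-middle rewrite circCoeff≡ h | circCoeff≡ (suc h) | fromℕ-suc h | Nℚ≡
    = solve 2 (λ σ y →
        σ :* (((con (fromℕ 3) :+ (y :+ y)) :- con 2ℚ :* y) :* con ½)
        :+ (:- σ) :* (((con (fromℕ 3) :+ (y :+ y)) :- con 2ℚ :* (con 1ℚ :+ y)) :* con ½)
        :+ ((:- σ) :* (((con (fromℕ 3) :+ (y :+ y)) :- con 2ℚ :* (con 1ℚ :+ y)) :* con ½)
          :+ (:- σ) :* (((con (fromℕ 3) :+ (y :+ y)) :- con 2ℚ :* (con 1ℚ :+ y)) :* con ½))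
        := con 0ℚ) refl (signPow h) (fromℕ h)

  circCoeff-ends : circCoeff 1 + circCoeff 1 + (circCoeff 0 + circCoeff 0) ≡ 1ℚ + 1ℚ
  circCoeff-ends rewrite circCoeff≡ 1 | circCoeff≡ 0
    = solve 1 (λ x →
        (:- con 1ℚ) :* ((x :- con 2ℚ :* con (fromℕ 1)) :* con ½) :+ (:- con 1ℚ) :* ((x :- con 2ℚ :* con (fromℕ 1)) :* con ½)
        :+ (con 1ℚ :* ((x :- con 2ℚ :* con (fromℕ 0)) :* con ½) :+ con 1ℚ :* ((x :- con 2ℚ :* con (fromℕ 0)) :* con ½))
        := con 1ℚ :+ con 1ℚ) refl Nℚ

  circEntry : ℕ → ℚ
  circEntry r = circCoeff (circIndex r)

  circEntry-neighbours : ∀ r {a b c} → circIndex (prev r) ≡ a → circIndex (next r) ≡ b → circIndex r ≡ c →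
    circEntry (prev r) + circEntry (next r) + (circEntry r + circEntry r) ≡ circCoeff a + circCoeff b + (circCoeff c + circCoeff c)
  circEntry-neighbours r refl refl refl = refl

  circIndex-K : circIndex K ≡ 1
  circIndex-K = trans (circIndex-> K 1+h<K) (ℕP.m+n∸n≡m 1 K)

  circIndex-2+h : circIndex (suc (suc h)) ≡ suc h
  circIndex-2+h = trans (circIndex-> (suc (suc h)) (ℕP.n<1+n (suc h))) (ℕP.m+n∸n≡m (suc h) h)

  circIndex-3+h : circIndex (next (suc (suc h))) ≡ h
  circIndex-3+h with next-view (suc (suc h)) 2+h<N
  ... | inj₁ (_ , next≡) = trans (cong circIndex next≡)
          (trans (circIndex-> (suc (suc (suc h))) (s≤s (ℕP.n≤1+n (suc h)))) (ℕP.m+n∸n≡m h h))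
  ... | inj₂ (2+h≡K , next≡) = trans (cong circIndex next≡) (sym (h≡0 (ℕP.suc-injective (ℕP.suc-injective 2+h≡K))))
    where
    h≡0 : h ≡ h ℕ.+ h → h ≡ 0
    h≡0 e = sym (ℕP.+-cancelˡ-≡ h 0 h (trans (ℕP.+-identityʳ h) e))

  private
    0+0 : 0ℚ ≡ 0ℚ + 0ℚ
    0+0 = sym (ℚP.+-identityʳ 0ℚ)

    swap : ∀ a b d → a + b + d ≡ b + a + d
    swap a b d = cong (_+ d) (ℚP.+-comm a b)

  -- Away from the ends the offsets r − 1, r, r + 1 fold to consecutive indices (reversed past the
  -- middle), and at the fold h + 1 | h + 2 the oddness of N makes circCoeff-middle apply.
  circEntry-secondDifference : ∀ r → r < N →
    circEntry (prev r) + circEntry (next r) + (circEntry r + circEntry r) ≡ δ r 0 + δ r 0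
  circEntry-secondDifference zero _ = trans (circEntry-neighbours 0 circIndex-K refl refl) circCoeff-ends
  circEntry-secondDifference (suc r) r<K with ℕP.<-cmp r h
  ... | tri< r<h _ _ = trans (circEntry-neighbours (suc r)
          (circIndex-≤ r (ℕP.m≤n⇒m≤1+n (ℕP.<⇒≤ r<h)))
          (trans (cong circIndex (next-< (suc r) (ℕP.<-trans (s≤s (s≤s r<h)) 2+h<N))) (circIndex-≤ (suc (suc r)) (s≤s r<h)))
          (circIndex-≤ (suc r) (ℕP.m≤n⇒m≤1+n r<h)))
        (trans (circCoeff-interior r) 0+0)
  ... | tri≈ _ refl _ = trans (circEntry-neighbours (suc h)
          (circIndex-≤ h (ℕP.n≤1+n h))
          (trans (cong circIndex (next-< (suc h) 2+h<N)) circIndex-2+h)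
          (circIndex-≤ (suc h) ℕP.≤-refl))
        (trans circCoeff-middle 0+0)
  ... | tri> _ _ h<r with r ℕP.≟ suc h
  ... | yes refl = trans (circEntry-neighbours (suc (suc h)) (circIndex-≤ (suc h) ℕP.≤-refl) circIndex-3+h circIndex-2+h)
        (trans (swap (circCoeff (suc h)) (circCoeff h) _) (trans circCoeff-middle 0+0))
  ... | no r≢1+h = trans (circEntry-neighbours (suc r) index-prev index-next index-self)
        (trans (swap (circCoeff (suc (suc j))) (circCoeff j) _) (trans (circCoeff-interior j) 0+0))
    where
    1+h<r : suc h < r
    1+h<r = ℕP.≤∧≢⇒< h<r (λ e → r≢1+h (sym e))
    j = N ∸ suc (suc r)
    index-self : circIndex (suc r) ≡ suc j
    index-self = trans (circIndex-> (suc r) (ℕP.m≤n⇒m≤1+n 1+h<r)) (ℕP.+-∸-assoc 1 r<K)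
    index-prev : circIndex r ≡ suc (suc j)
    index-prev = trans (circIndex-> r 1+h<r)
      (trans (ℕP.+-∸-assoc 1 (ℕP.<-trans (ℕP.n<1+n r) r<K)) (cong suc (ℕP.+-∸-assoc 1 r<K)))
    index-next : circIndex (next (suc r)) ≡ j
    index-next with next-view (suc r) r<K
    ... | inj₁ (_ , next≡) = trans (cong circIndex next≡) (circIndex-> (suc (suc r)) (ℕP.m≤n⇒m≤1+n (ℕP.m≤n⇒m≤1+n 1+h<r)))
    ... | inj₂ (1+r≡K , next≡) = trans (cong circIndex next≡) (sym (trans (cong (λ t → N ∸ suc t) 1+r≡K) (ℕP.n∸n≡0 N)))

  signPow*circWeight*if : ∀ k b → signPow k * (circWeight k * (if b then 1ℚ else 0ℚ)) ≡ (if b then circCoeff k else 0ℚ)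
  signPow*circWeight*if k true = cong (signPow k *_) (ℚP.*-identityʳ (circWeight k))
  signPow*circWeight*if k false = trans (cong (signPow k *_) (ℚP.*-zeroʳ (circWeight k))) (ℚP.*-zeroʳ (signPow k))

  lapCircSum : ℕ → ℚ
  lapCircSum r = sumTo (suc h) (λ k → signPow k * (circWeight k * cvec n k (suc r)))

  1≢N∸ : ∀ k → k ≤ suc h → ¬ (1 ≡ N ∸ k)
  1≢N∸ k le e = ℕP.<⇒≱ 2+h<N (subst (_≤ suc (suc h)) (sym eN) (s≤s le))
    where
    eN : N ≡ suc k
    eN = trans (sym (ℕP.m∸n+n≡m (ℕP.≤-trans le (ℕP.<⇒≤ (ℕP.<-trans 1+h<K (ℕP.n<1+n K)))))) (cong (ℕ._+ k) (sym e))

  lapCircSum-0 : lapCircSum 0 ≡ 0ℚ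
  lapCircSum-0 = sumTo-zero (suc h) _ f
    where
    f : ∀ k → 1 ≤ k → k ≤ suc h → signPow k * (circWeight k * cvec n k 1) ≡ 0ℚ
    f (suc k) _ le = trans (cong (λ b → signPow (suc k) * (circWeight (suc k) * (if b then 1ℚ else 0ℚ)))
                                 (≢⇒≡ᵇ-false 1 (N ∸ k) (1≢N∸ k (ℕP.m≤n⇒m≤1+n (ℕP.≤-pred le)))))
                           (signPow*circWeight*if (suc k) false)

  1+h≤N : suc h ≤ N
  1+h≤N = ℕP.<⇒≤ (ℕP.<-trans 1+h<K (ℕP.n<1+n K))

  circIndex-range : ∀ r → 1 ≤ r → r < N → (1 ≤ circIndex r) × (circIndex r ≤ suc h)
  circIndex-range r l1 l2 with r ℕP.≤? suc h
  ... | yes le = subst (1 ≤_) (sym (circIndex-≤ r le)) l1 , subst (_≤ suc h) (sym (circIndex-≤ r le)) le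
  ... | no nle = subst (1 ≤_) (sym (trans (circIndex-> r (ℕP.≰⇒> nle)) (ℕP.+-∸-assoc 1 l2))) (s≤s z≤n) ,
                 subst (_≤ suc h) (sym (circIndex-> r (ℕP.≰⇒> nle)))
                   (ℕP.≤-trans (ℕP.∸-monoʳ-≤ N (ℕP.≰⇒> nle)) (ℕP.≤-reflexive (ℕP.m+n∸n≡m (suc h) h)))

  cvec≡circIndex : ∀ r k → 1 ≤ r → r < N → k ≤ h → ((r ≡ᵇ suc k) ∨ (suc r ≡ᵇ N ∸ k)) ≡ (suc k ≡ᵇ circIndex r)
  cvec≡circIndex r k l1 l2 lk = ≡true-ext f g
    where
    k≤N : k ≤ N
    k≤N = ℕP.≤-trans (ℕP.m≤n⇒m≤1+n lk) 1+h≤N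
    f : ((r ≡ᵇ suc k) ∨ (suc r ≡ᵇ N ∸ k)) ≡ true → (suc k ≡ᵇ circIndex r) ≡ true
    f e with ∨-elim {r ≡ᵇ suc k} e
    ... | inj₁ e1 = ≡⇒≡ᵇ-true (sym (trans (circIndex-≤ r (subst (_≤ suc h) (sym r≡1+k) (s≤s lk))) r≡1+k))
      where r≡1+k = ≡ᵇ-true⇒≡ r (suc k) e1
    ... | inj₂ e2 = ≡⇒≡ᵇ-true (sym (trans (circIndex-> r gt) (trans (cong (_∸ r) (sym eN′)) (ℕP.m+n∸m≡n r (suc k)))))
      where
      eN : suc r ℕ.+ k ≡ N
      eN = trans (cong (ℕ._+ k) (≡ᵇ-true⇒≡ (suc r) (N ∸ k) e2)) (ℕP.m∸n+n≡m k≤N)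
      eN′ : r ℕ.+ suc k ≡ N
      eN′ = trans (ℕP.+-suc r k) eN
      gt : suc h < r
      gt = ℕP.≰⇒> (λ le → ℕP.<⇒≱ (ℕP.n<1+n (suc (suc (h ℕ.+ h)))) (subst (_≤ suc (suc (h ℕ.+ h))) eN (ℕP.+-mono-≤ (s≤s le) lk)))
    g : (suc k ≡ᵇ circIndex r) ≡ true → ((r ≡ᵇ suc k) ∨ (suc r ≡ᵇ N ∸ k)) ≡ true
    g e with r ℕP.≤? suc h
    ... | yes le = ∨-introˡ (≡⇒≡ᵇ-true (trans (sym (circIndex-≤ r le)) (sym (≡ᵇ-true⇒≡ (suc k) (circIndex r) e))))
    ... | no nle = ∨-introʳ {r ≡ᵇ suc k} (≡⇒≡ᵇ-true (sym eNk))
      where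
      dr : N ∸ r ≡ suc k
      dr = trans (sym (circIndex-> r (ℕP.≰⇒> nle))) (sym (≡ᵇ-true⇒≡ (suc k) (circIndex r) e))
      eN : N ≡ suc r ℕ.+ k
      eN = trans (sym (ℕP.m+[n∸m]≡n (ℕP.<⇒≤ l2))) (trans (cong (r ℕ.+_) dr) (ℕP.+-suc r k))
      eNk : N ∸ k ≡ suc r
      eNk = trans (cong (_∸ k) eN) (ℕP.m+n∸n≡m (suc r) k)

  lapCircSum≡circEntry : ∀ r → 1 ≤ r → r < N → lapCircSum r ≡ circEntry r
  lapCircSum≡circEntry r l1 l2 = sumTo-single (suc h) (circIndex r) circCoeff _ (proj₁ (circIndex-range r l1 l2)) (proj₂ (circIndex-range r l1 l2)) f
    where
    f : ∀ k → 1 ≤ k → k ≤ suc h → signPow k * (circWeight k * cvec n k (suc r)) ≡ (if k ≡ᵇ circIndex r then circCoeff k else 0ℚ)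
    f (suc k) _ le = trans (cong (λ b → signPow (suc k) * (circWeight (suc k) * (if b then 1ℚ else 0ℚ)))
                                 (cvec≡circIndex r k l1 l2 (ℕP.≤-pred le)))
                           (signPow*circWeight*if (suc k) (suc k ≡ᵇ circIndex r))

  circIndex-reflect : ∀ r → 1 ≤ r → r < N → circIndex (N ∸ r) ≡ circIndex r
  circIndex-reflect r l1 l2 with r ℕP.≤? suc h
  ... | yes le = trans (circIndex-> (N ∸ r) (ℕP.m+n≤o⇒m≤o∸n (suc (suc h)) le2)) (trans (ℕP.m∸[m∸n]≡n (ℕP.<⇒≤ l2)) (sym (circIndex-≤ r le)))
    where
    le2 : suc (suc h) ℕ.+ r ≤ N
    le2 = ℕP.≤-trans (ℕP.+-monoʳ-≤ (suc (suc h)) le) (ℕP.≤-reflexive (cong (λ t → suc (suc t)) (ℕP.+-suc h h)))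
  ... | no nle = trans (circIndex-≤ (N ∸ r) le3) (sym (circIndex-> r (ℕP.≰⇒> nle)))
    where
    le3 : N ∸ r ≤ suc h
    le3 = ℕP.≤-trans (ℕP.∸-monoʳ-≤ N (ℕP.≰⇒> nle)) (ℕP.≤-reflexive (ℕP.m+n∸n≡m (suc h) h))

  circEntry-offset-sym : ∀ p q → p < N → q < N → circEntry (offset q p) ≡ circEntry (offset p q)
  circEntry-offset-sym p q lp lq with p ℕP.≟ q
  ... | yes refl = refl
  ... | no p≢q = cong circCoeff (trans (cong circIndex (offset-swap p q lp lq p≢q))
      (circIndex-reflect (offset p q) (ℕP.n≢0⇒n>0 (p≢q ∘ offset≡0⇒≡ p q lp lq)) (offset<N p q lp lq)))

  onCentreDiag onSpoke onHubDiag onPendantEdge onPendantDiag : ℕ → ℕ → Bool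
  onCentreDiag a b = (a ≡ᵇ 1) ∧ (b ≡ᵇ 1)
  onSpoke a b = ((a ≡ᵇ 1) ∧ inRange 2 n b) ∨ ((b ≡ᵇ 1) ∧ inRange 2 n a)
  onHubDiag a b = inRange 2 n a ∧ (a ≡ᵇ b)
  onPendantEdge a b = (inRange 2 n a ∧ (b ≡ᵇ n ℕ.+ a ∸ 1)) ∨ (inRange 2 n b ∧ (a ≡ᵇ n ℕ.+ b ∸ 1))
  onPendantDiag a b = inRange (suc n) (helmOrder n) a ∧ (a ≡ᵇ b)

  centreDiag spokeEntry hubDiag pendantEdgeEntry pendantDiag : ℚ
  centreDiag = ½ * ((ℤ.+ (n ∸ 1)) ℚ./ 1)
  spokeEntry = ½ * (- 1ℚ)
  hubDiag = ½ * ((ℤ.+ suc n) ℚ./ 1)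
  pendantEdgeEntry = ½ * ((ℤ.- (ℤ.+ 2)) ℚ./ 1)
  pendantDiag = ½ * ((ℤ.+ 2) ℚ./ 1)

  lapBaseCase : Bool → Bool → Bool → Bool → Bool → ℚ
  lapBaseCase b1 b2 b3 b4 b5 = if b1 then centreDiag else if b2 then spokeEntry else if b3 then hubDiag else if b4 then pendantEdgeEntry else if b5 then pendantDiag else 0ℚ

  lapBase-cases : ∀ a b {b1 b2 b3 b4 b5} → onCentreDiag a b ≡ b1 → onSpoke a b ≡ b2 → onHubDiag a b ≡ b3 → onPendantEdge a b ≡ b4 → onPendantDiag a b ≡ b5 →
    lapBase n a b ≡ lapBaseCase b1 b2 b3 b4 b5
  lapBase-cases a b refl refl refl refl refl = refl

  lapCirc-outside : ∀ a b → (inRange 2 n a ∧ inRange 2 n b) ≡ false → lapCirc n a b ≡ 0ℚ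
  lapCirc-outside a b e = if-false {b = inRange 2 n a ∧ inRange 2 n b} _ 0ℚ e

  hubLabel-inRange : ∀ p → p < N → inRange 2 n (label (hub p)) ≡ true
  hubLabel-inRange p lp = ≤⇒≤ᵇ-true {label (hub p)} {n} (s≤s lp)

  pendantLabel-outOfRange : ∀ p → inRange 2 n (label (pendant p)) ≡ false
  pendantLabel-outOfRange p = >⇒≤ᵇ-false {label (pendant p)} {n} (s≤s (s≤s (ℕP.m≤m+n N p)))

  hubLabel-outOfPendantRange : ∀ p → p < N → inRange (suc n) (helmOrder n) (label (hub p)) ≡ false
  hubLabel-outOfPendantRange p lp = ∧-falseˡ (>⇒≤ᵇ-false {suc n} {label (hub p)} (s≤s (s≤s lp)))

  pendantLabel-inPendantRange : ∀ p → p < N → inRange (suc n) (helmOrder n) (label (pendant p)) ≡ true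
  pendantLabel-inPendantRange p lp = ∧-intro (≤⇒≤ᵇ-true {suc n} {label (pendant p)} (s≤s (s≤s (ℕP.m≤m+n N p))))
                     (≤⇒≤ᵇ-true {label (pendant p)} {helmOrder n} (subst (label (pendant p) ≤_) (sym m≡1+N+N) (s≤s (ℕP.+-monoʳ-< N lp))))

  N+-≡ᵇ : ∀ p q → (N ℕ.+ p ≡ᵇ N ℕ.+ q) ≡ (p ≡ᵇ q)
  N+-≡ᵇ p q = ≡true-ext (λ e → ≡⇒≡ᵇ-true (ℕP.+-cancelˡ-≡ N p q (≡ᵇ-true⇒≡ _ _ e)))
                        (λ e → ≡⇒≡ᵇ-true (cong (N ℕ.+_) (≡ᵇ-true⇒≡ p q e)))

  pendantLabel-≡ᵇ : ∀ p q → (label (pendant p) ≡ᵇ N ℕ.+ label (hub q)) ≡ (p ≡ᵇ q)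
  pendantLabel-≡ᵇ p q = trans (cong (λ z → label (pendant p) ≡ᵇ z) (+-suc² q)) (N+-≡ᵇ p q)

  hubLabel-≢ᵇ : ∀ q p → q < N → (label (hub q) ≡ᵇ N ℕ.+ label (hub p)) ≡ false
  hubLabel-≢ᵇ q p lq = ≢⇒≡ᵇ-false (label (hub q)) (N ℕ.+ label (hub p)) (λ e → <N⇒≢N+ q p lq (ℕP.suc-injective (ℕP.suc-injective (trans e (+-suc² p)))))

  <N⇒≢ᵇN+ : ∀ p q → p < N → (p ≡ᵇ N ℕ.+ q) ≡ false
  <N⇒≢ᵇN+ p q lp = ≢⇒≡ᵇ-false p (N ℕ.+ q) (<N⇒≢N+ p q lp)

  lapℕ : ℕ → ℕ → ℚ
  lapℕ a b = lapBase n a b + lapCirc n a b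

  lap : Vertex → Vertex → ℚ
  lap x y = lapℕ (label x) (label y)

  n/2∸1≡1+h : n ℕ./ 2 ∸ 1 ≡ suc h
  n/2∸1≡1+h = cong (_∸ 1) (trans (cong (ℕ._/ 2) (sym [2+h]*2≡n)) (ℕD.m*n/n≡m (suc (suc h)) 2))

  lapCirc-hub : ∀ p q → p < N → q < N → lapCirc n (label (hub p)) (label (hub q)) ≡ lapCircSum (offset p q)
  lapCirc-hub p q lp lq = trans (if-true _ 0ℚ (∧-intro (hubLabel-inRange p lp) (hubLabel-inRange q lq)))
    (cong (λ t → sumTo t (λ k → signPow k * (circWeight k * cvec n k (suc (offset p q))))) n/2∸1≡1+h)

  lap-offHubs : ∀ x y {v} → (inRange 2 n (label x) ∧ inRange 2 n (label y)) ≡ false →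
    lapBase n (label x) (label y) ≡ v → lap x y ≡ v
  lap-offHubs x y {v} off base = trans (cong₂ _+_ base (lapCirc-outside (label x) (label y) off)) (ℚP.+-identityʳ v)

  lap-centre-centre : lap centre centre ≡ centreDiag
  lap-centre-centre = lap-offHubs centre centre refl refl

  lap-centre-hub : ∀ q → q < N → lap centre (hub q) ≡ spokeEntry
  lap-centre-hub q lq = lap-offHubs centre (hub q) refl
    (lapBase-cases 1 (label (hub q)) refl (∨-introˡ (hubLabel-inRange q lq)) refl refl refl)

  lap-hub-centre : ∀ p → p < N → lap (hub p) centre ≡ spokeEntry
  lap-hub-centre p lp = lap-offHubs (hub p) centre (∧-falseʳ refl)
    (lapBase-cases (label (hub p)) 1 refl (hubLabel-inRange p lp) refl refl refl)

  lap-centre-pendant : ∀ q → lap centre (pendant q) ≡ 0ℚ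
  lap-centre-pendant q = lap-offHubs centre (pendant q) refl
    (lapBase-cases 1 (label (pendant q)) refl (∨-false (pendantLabel-outOfRange q) refl) refl (∧-falseˡ (pendantLabel-outOfRange q)) refl)

  lap-pendant-centre : ∀ p → p < N → lap (pendant p) centre ≡ 0ℚ
  lap-pendant-centre p lp = lap-offHubs (pendant p) centre (∧-falseˡ out)
    (lapBase-cases (label (pendant p)) 1 refl out (∧-falseˡ out) (∨-false (∧-falseˡ out) refl) (∧-falseʳ refl))
    where out = pendantLabel-outOfRange p

  lap-hub-pendant : ∀ p q → p < N → q < N → lap (hub p) (pendant q) ≡ - δ p q
  lap-hub-pendant p q lp lq with p ℕP.≟ q
  ... | yes refl = trans (lap-offHubs (hub p) (pendant p) (∧-falseʳ (pendantLabel-outOfRange p))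
          (lapBase-cases (label (hub p)) (label (pendant p)) refl refl (∧-falseʳ (<N⇒≢ᵇN+ p p lp))
            (∨-introˡ (∧-intro (hubLabel-inRange p lp) (trans (pendantLabel-≡ᵇ p p) (≡ᵇ-refl p)))) refl))
        (cong -_ (sym (δ-refl p)))
  ... | no p≢q = trans (lap-offHubs (hub p) (pendant q) (∧-falseʳ (pendantLabel-outOfRange q))
          (lapBase-cases (label (hub p)) (label (pendant q)) refl refl (∧-falseʳ (<N⇒≢ᵇN+ p q lp))
            (∨-false (∧-falseʳ (trans (pendantLabel-≡ᵇ q p) (≢⇒≡ᵇ-false q p (p≢q ∘ sym)))) (∧-falseˡ (pendantLabel-outOfRange q)))
            (∧-falseˡ (hubLabel-outOfPendantRange p lp))))
        (cong -_ (sym (δ-≢ p q p≢q)))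

  lap-pendant-hub : ∀ p q → p < N → q < N → lap (pendant p) (hub q) ≡ - δ p q
  lap-pendant-hub p q lp lq with p ℕP.≟ q
  ... | yes refl = trans (lap-offHubs (pendant p) (hub p) (∧-falseˡ out)
          (lapBase-cases (label (pendant p)) (label (hub p)) refl refl (∧-falseˡ out)
            (∨-false-true (∧-falseˡ out) (∧-intro (hubLabel-inRange p lp) (trans (pendantLabel-≡ᵇ p p) (≡ᵇ-refl p)))) refl))
        (cong -_ (sym (δ-refl p)))
    where out = pendantLabel-outOfRange p
  ... | no p≢q = trans (lap-offHubs (pendant p) (hub q) (∧-falseˡ out)
          (lapBase-cases (label (pendant p)) (label (hub q)) refl refl (∧-falseˡ out)
            (∨-false (∧-falseˡ out) (∧-falseʳ (trans (pendantLabel-≡ᵇ p q) (≢⇒≡ᵇ-false p q p≢q))))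
            (∧-falseʳ (trans (≡ᵇ-sym (N ℕ.+ p) q) (<N⇒≢ᵇN+ q p lq)))))
        (cong -_ (sym (δ-≢ p q p≢q)))
    where out = pendantLabel-outOfRange p

  lap-pendant-pendant : ∀ p q → p < N → q < N → lap (pendant p) (pendant q) ≡ δ p q
  lap-pendant-pendant p q lp lq with p ℕP.≟ q
  ... | yes refl = trans (lap-offHubs (pendant p) (pendant p) (∧-falseˡ out)
          (lapBase-cases (label (pendant p)) (label (pendant p)) refl refl (∧-falseˡ out) (∨-false (∧-falseˡ out) (∧-falseˡ out))
            (∧-intro (pendantLabel-inPendantRange p lp) (≡ᵇ-refl (N ℕ.+ p)))))
        (sym (δ-refl p))
    where out = pendantLabel-outOfRange p
  ... | no p≢q = trans (lap-offHubs (pendant p) (pendant q) (∧-falseˡ out)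
          (lapBase-cases (label (pendant p)) (label (pendant q)) refl refl (∧-falseˡ out)
            (∨-false (∧-falseˡ out) (∧-falseˡ (pendantLabel-outOfRange q))) (∧-falseʳ (trans (N+-≡ᵇ p q) (≢⇒≡ᵇ-false p q p≢q)))))
        (sym (δ-≢ p q p≢q))
    where out = pendantLabel-outOfRange p

  hubDiag≡ : hubDiag ≡ circCoeff 0 + 1ℚ
  hubDiag≡ = trans (cong (½ *_) (trans (fromℕ-suc (suc N)) (cong (1ℚ +_) (fromℕ-suc N))))
    (trans (solve 1 (λ x → con ½ :* (con 1ℚ :+ (con 1ℚ :+ x))
                        := con 1ℚ :* ((x :- con 2ℚ :* con (fromℕ 0)) :* con ½) :+ con 1ℚ) refl Nℚ)
      (cong (_+ 1ℚ) (sym (circCoeff≡ 0))))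

  lap-hub-hub : ∀ p q → p < N → q < N → lap (hub p) (hub q) ≡ circEntry (offset p q) + δ p q
  lap-hub-hub p q lp lq with p ℕP.≟ q
  ... | yes refl = begin
    lapBase n (label (hub p)) (label (hub p)) + lapCirc n (label (hub p)) (label (hub p))
      ≡⟨ cong (_+ lapCirc n (label (hub p)) (label (hub p)))
           (lapBase-cases (label (hub p)) (label (hub p)) refl refl (∧-intro (hubLabel-inRange p lp) (≡ᵇ-refl p)) refl refl) ⟩
    hubDiag + lapCirc n (label (hub p)) (label (hub p))
      ≡⟨ cong (hubDiag +_) (trans (lapCirc-hub p p lp lp) (trans (cong lapCircSum (offset-refl p lp)) lapCircSum-0)) ⟩
    hubDiag + 0ℚ                      ≡⟨ ℚP.+-identityʳ hubDiag ⟩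
    hubDiag                           ≡⟨ hubDiag≡ ⟩
    circCoeff 0 + 1ℚ                  ≡⟨ cong₂ _+_ (cong circEntry (offset-refl p lp)) (δ-refl p) ⟨
    circEntry (offset p p) + δ p p    ∎
    where open ≡-Reasoning
  ... | no p≢q = begin
    lapBase n (label (hub p)) (label (hub q)) + lapCirc n (label (hub p)) (label (hub q))
      ≡⟨ cong₂ _+_ offDiagonal (lapCirc-hub p q lp lq) ⟩
    0ℚ + lapCircSum (offset p q)
      ≡⟨ ℚP.+-identityˡ _ ⟩
    lapCircSum (offset p q)
      ≡⟨ lapCircSum≡circEntry (offset p q) (ℕP.n≢0⇒n>0 (p≢q ∘ offset≡0⇒≡ p q lp lq)) (offset<N p q lp lq) ⟩
    circEntry (offset p q)
      ≡⟨ ℚP.+-identityʳ _ ⟨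
    circEntry (offset p q) + 0ℚ
      ≡⟨ cong (circEntry (offset p q) +_) (δ-≢ p q p≢q) ⟨
    circEntry (offset p q) + δ p q ∎
    where
    open ≡-Reasoning
    offDiagonal : lapBase n (label (hub p)) (label (hub q)) ≡ 0ℚ
    offDiagonal = lapBase-cases (label (hub p)) (label (hub q)) refl refl (∧-falseʳ (≢⇒≡ᵇ-false p q p≢q))
      (∨-false (∧-falseʳ {inRange 2 n (label (hub p))} (hubLabel-≢ᵇ q p lq)) (∧-falseʳ {inRange 2 n (label (hub q))} (hubLabel-≢ᵇ p q lp)))
      (∧-falseˡ (hubLabel-outOfPendantRange p lp))

  lap-sym : ∀ x y → IsVertex x → IsVertex y → lap x y ≡ lap y x
  lap-sym centre centre _ _ = refl
  lap-sym centre (hub q) _ lq = trans (lap-centre-hub q lq) (sym (lap-hub-centre q lq))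
  lap-sym (hub p) centre lp _ = trans (lap-hub-centre p lp) (sym (lap-centre-hub p lp))
  lap-sym centre (pendant q) _ lq = trans (lap-centre-pendant q) (sym (lap-pendant-centre q lq))
  lap-sym (pendant p) centre lp _ = trans (lap-pendant-centre p lp) (sym (lap-centre-pendant p))
  lap-sym (hub p) (hub q) lp lq = trans (lap-hub-hub p q lp lq) (trans (cong₂ _+_ (sym (circEntry-offset-sym p q lp lq)) (δ-sym p q)) (sym (lap-hub-hub q p lq lp)))
  lap-sym (hub p) (pendant q) lp lq = trans (lap-hub-pendant p q lp lq) (trans (cong -_ (δ-sym p q)) (sym (lap-pendant-hub q p lq lp)))
  lap-sym (pendant p) (hub q) lp lq = trans (lap-pendant-hub p q lp lq) (trans (cong -_ (δ-sym p q)) (sym (lap-hub-pendant q p lq lp)))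
  lap-sym (pendant p) (pendant q) lp lq = trans (lap-pendant-pendant p q lp lq) (trans (δ-sym p q) (sym (lap-pendant-pendant q p lq lp)))

  uℕ : ℕ → ℚ
  uℕ a = if a ≡ᵇ 1 then ((ℤ.+ 5) ℤ.- (ℤ.+ n)) ℚ./ 4
         else if inRange 2 n a then (ℤ.- (ℤ.+ 1)) ℚ./ 4
         else (ℤ.+ 2) ℚ./ 4

  u : Vertex → ℚ
  u x = uℕ (label x)

  u-centre u-hub u-pendant ¼ : ℚ
  u-centre = ((ℤ.+ 5) ℤ.- (ℤ.+ n)) ℚ./ 4
  u-hub = (ℤ.- (ℤ.+ 1)) ℚ./ 4
  u-pendant = (ℤ.+ 2) ℚ./ 4
  ¼ = (ℤ.+ 1) ℚ./ 4

  u-centre≡ : u-centre ≡ (fromℕ 5 - (1ℚ + Nℚ)) * ¼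
  u-centre≡ = trans (/-as-* ((ℤ.+ 5) ℤ.- (ℤ.+ n)) 3) (cong (_* ¼) (trans (fromℤ-sub 5 n) (cong (λ t → fromℕ 5 - t) (fromℕ-suc N))))

  u-at-hub : ∀ p → p < N → u (hub p) ≡ u-hub
  u-at-hub p lp = if-true u-hub u-pendant (hubLabel-inRange p lp)

  u-at-pendant : ∀ p → u (pendant p) ≡ u-pendant
  u-at-pendant p = if-false u-hub u-pendant (pendantLabel-outOfRange p)

  distℚ : Vertex → Vertex → ℚ
  distℚ x y = fromℕ (dist x y)

  cycleDistℚ : ℕ → ℕ → ℚ
  cycleDistℚ p q = fromℕ (cycleDist p q)

  if0else2≡ : ∀ b → fromℕ (if b then 0 else 2) ≡ 2ℚ - 2ℚ * (if b then 1ℚ else 0ℚ)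
  if0else2≡ true = refl
  if0else2≡ false = refl

  distℚ-pendant-pendant : ∀ p q → distℚ (pendant p) (pendant q) ≡ cycleDistℚ p q + (2ℚ - 2ℚ * δ p q)
  distℚ-pendant-pendant p q = trans (fromℕ-+ (cycleDist p q) _) (cong (cycleDistℚ p q +_) (if0else2≡ (p ≡ᵇ q)))

  identityV : Vertex → Vertex → ℚ
  identityV x y = if index x ≡ᵇ index y then 1ℚ else 0ℚ

  identityV-hub-pendant : ∀ p q → p < N → identityV (hub p) (pendant q) ≡ 0ℚ
  identityV-hub-pendant p q lp = cong (λ b → if b then 1ℚ else 0ℚ) (<N⇒≢ᵇN+ p q lp)

  identityV-pendant-hub : ∀ p q → q < N → identityV (pendant p) (hub q) ≡ 0ℚ
  identityV-pendant-hub p q lq = cong (λ b → if b then 1ℚ else 0ℚ) (trans (≡ᵇ-sym (N ℕ.+ p) q) (<N⇒≢ᵇN+ q p lq))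

  identityV-pendant-pendant : ∀ p q → identityV (pendant p) (pendant q) ≡ δ p q
  identityV-pendant-pendant p q = cong (λ b → if b then 1ℚ else 0ℚ) (N+-≡ᵇ p q)

  -- Opaque so that conversion checking never unfolds the N-fold sum.
  opaque
    ∑cyc : (ℕ → ℚ) → ℚ
    ∑cyc f = sumℕ N f

    ∑cyc-def : ∀ f → ∑cyc f ≡ sumℕ N f
    ∑cyc-def f = refl

    ∑cyc-+ : ∀ (f g : ℕ → ℚ) → ∑cyc (λ t → f t + g t) ≡ ∑cyc f + ∑cyc g
    ∑cyc-+ f g = sumℕ-+ N f g

    ∑cyc-* : ∀ a (f : ℕ → ℚ) → ∑cyc (λ t → a * f t) ≡ a * ∑cyc f
    ∑cyc-* a f = sumℕ-* N a f

    ∑cyc-neg : ∀ (f : ℕ → ℚ) → ∑cyc (λ t → - f t) ≡ - ∑cyc f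
    ∑cyc-neg f = sumℕ-neg N f

    ∑cyc-sub : ∀ (f g : ℕ → ℚ) → ∑cyc (λ t → f t - g t) ≡ ∑cyc f - ∑cyc g
    ∑cyc-sub f g = trans (sumℕ-+ N f (λ t → - g t)) (cong (λ t → sumℕ N f + t) (sumℕ-neg N g))

    ∑cyc-cong : ∀ (f g : ℕ → ℚ) → (∀ t → t < N → f t ≡ g t) → ∑cyc f ≡ ∑cyc g
    ∑cyc-cong f g e = sumℕ-cong N f g e

    ∑cyc-const : ∀ a → ∑cyc (λ _ → a) ≡ Nℚ * a
    ∑cyc-const a = sumℕ-const N a

    ∑cyc-δˡ : ∀ a (f : ℕ → ℚ) → a < N → ∑cyc (λ s → δ a s * f s) ≡ f a
    ∑cyc-δˡ a f l = sumℕ-δˡ N a f l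

    ∑cyc-δʳ : ∀ a (f : ℕ → ℚ) → a < N → ∑cyc (λ s → δ s a * f s) ≡ f a
    ∑cyc-δʳ a f l = sumℕ-δʳ N a f l

    ∑cyc-prev : ∀ (f : ℕ → ℚ) → ∑cyc (λ p → f (prev p)) ≡ ∑cyc f
    ∑cyc-prev f = trans (ℚP.+-comm (f K) _) (sym (sumℕ-last K f))

    ∑cyc-next : ∀ (f : ℕ → ℚ) → ∑cyc (λ p → f (next p)) ≡ ∑cyc f
    ∑cyc-next f = trans (sumℕ-last K (λ p → f (next p)))
      (trans (cong₂ _+_ (sumℕ-cong K _ _ (λ t lt → cong f (next-< t (s≤s lt)))) (cong f next-last))
        (ℚP.+-comm _ (f 0)))

  ∑cyc-neighbours : ∀ (f : ℕ → ℚ) → ∑cyc (λ p → f (prev p) + f (next p) + (f p + f p)) ≡ ∑cyc f + ∑cyc f + (∑cyc f + ∑cyc f)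
  ∑cyc-neighbours f = trans (∑cyc-+ _ _) (cong₂ _+_ (trans (∑cyc-+ _ _) (cong₂ _+_ (∑cyc-prev f) (∑cyc-next f))) (∑cyc-+ f f))

  ∑cyc-δ : ∀ a → a < N → ∑cyc (λ s → δ s a) ≡ 1ℚ
  ∑cyc-δ a l = trans (∑cyc-cong _ _ (λ t _ → sym (ℚP.*-identityʳ (δ t a)))) (∑cyc-δʳ a (λ _ → 1ℚ) l)

  private
    cycleDistForm-cong : ∀ {a b d a′ b′ d′ : ℚ} → a ≡ a′ → b ≡ b′ → d ≡ d′ → 2ℚ - (2ℚ * a + b + d) ≡ 2ℚ - (2ℚ * a′ + b′ + d′)
    cycleDistForm-cong refl refl refl = refl

  cycleDistℚ≡ : ∀ p s → p < N → s < N → cycleDistℚ p s ≡ 2ℚ - (2ℚ * δ p s + δ (next p) s + δ (prev p) s)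
  cycleDistℚ≡ p s lp ls with cycleDist-view p s
  ... | inj₁ (refl , e0) = trans (cong fromℕ e0) (sym (cycleDistForm-cong (δ-refl p) (δ-≢ _ _ (next≢ p lp ∘ sym)) (δ-≢ _ _ (prev≢ p lp))))
  ... | inj₂ (inj₁ (ne , inj₁ e1 , e)) = trans (cong fromℕ e) (sym (cycleDistForm-cong (δ-≢ p s ne)
          (trans (cong (δ (next p)) e1) (δ-refl (next p))) (δ-≢ _ _ (λ z → next≢prev p lp (sym (trans z e1))))))
  ... | inj₂ (inj₁ (ne , inj₂ e2 , e)) = trans (cong fromℕ e) (sym (cycleDistForm-cong (δ-≢ p s ne)
          (δ-≢ _ _ (λ z → next≢prev p lp (trans z (sym es))))
          (trans (cong (λ t → δ t s) es) (δ-refl s))))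
    where
    es : prev p ≡ s
    es = trans (cong prev e2) (prev-next s ls)
  ... | inj₂ (inj₂ (ne , n1 , n2 , e)) = trans (cong fromℕ e) (sym (cycleDistForm-cong (δ-≢ p s ne)
          (δ-≢ _ _ (λ z → n1 (sym z)))
          (δ-≢ _ _ (λ z → n2 (trans (sym (next-prev p lp)) (cong next z))))))

  distSum : ℕ → (ℕ → ℚ) → ℚ
  distSum p f = 2ℚ * ∑cyc f - (2ℚ * f p + f (next p) + f (prev p))

  ∑cyc-cycleDist : ∀ p (f : ℕ → ℚ) → p < N → ∑cyc (λ s → cycleDistℚ p s * f s) ≡ distSum p f
  ∑cyc-cycleDist p f lp = begin
    ∑cyc (λ s → cycleDistℚ p s * f s)
      ≡⟨ ∑cyc-cong _ _ (λ s ls → trans (cong (_* f s) (cycleDistℚ≡ p s lp ls)) (distrib s)) ⟩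
    ∑cyc (λ s → 2ℚ * f s - (2ℚ * (δ p s * f s) + δ (next p) s * f s + δ (prev p) s * f s))
      ≡⟨ ∑cyc-sub _ _ ⟩
    ∑cyc (λ s → 2ℚ * f s) - ∑cyc (λ s → 2ℚ * (δ p s * f s) + δ (next p) s * f s + δ (prev p) s * f s)
      ≡⟨ cong₂ _-_ (∑cyc-* 2ℚ f) (trans (∑cyc-+ _ _) (cong₂ _+_ (trans (∑cyc-+ _ _)
            (cong₂ _+_ (trans (∑cyc-* 2ℚ _) (cong (2ℚ *_) (∑cyc-δˡ p f lp))) (∑cyc-δˡ (next p) f (next<N p lp))))
            (∑cyc-δˡ (prev p) f (prev<N p lp)))) ⟩
    distSum p f ∎
    where
    open ≡-Reasoning
    distrib : ∀ s → (2ℚ - (2ℚ * δ p s + δ (next p) s + δ (prev p) s)) * f s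
                  ≡ 2ℚ * f s - (2ℚ * (δ p s * f s) + δ (next p) s * f s + δ (prev p) s * f s)
    distrib s = solve 4 (λ a b d y → (con 2ℚ :- (con 2ℚ :* a :+ b :+ d)) :* y
                                    := con 2ℚ :* y :- (con 2ℚ :* (a :* y) :+ b :* y :+ d :* y))
                  refl (δ p s) (δ (next p) s) (δ (prev p) s) (f s)

  distSum-cong : ∀ p (f g : ℕ → ℚ) → p < N → (∀ s → s < N → f s ≡ g s) → distSum p f ≡ distSum p g
  distSum-cong p f g lp e = cong₂ (λ a b → 2ℚ * a - b) (∑cyc-cong f g e)
    (cong₂ _+_ (cong₂ _+_ (cong (2ℚ *_) (e p lp)) (e (next p) (next<N p lp))) (e (prev p) (prev<N p lp)))

  ∑cyc-constant : ∀ (f : ℕ → ℚ) a → (∀ s → s < N → f s ≡ a) → ∑cyc f ≡ Nℚ * a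
  ∑cyc-constant f a e = trans (∑cyc-cong f (λ _ → a) e) (∑cyc-const a)

  distSum-constant : ∀ p (f : ℕ → ℚ) a → p < N → (∀ s → s < N → f s ≡ a) → distSum p f ≡ 2ℚ * (Nℚ * a) - (2ℚ * a + a + a)
  distSum-constant p f a lp e = trans (distSum-cong p f (λ _ → a) lp e) (cong (λ t → 2ℚ * t - (2ℚ * a + a + a)) (∑cyc-const a))

  distSum-neg : ∀ p (f : ℕ → ℚ) → distSum p (λ s → - f s) ≡ - distSum p f
  distSum-neg p f = trans (cong (λ t → 2ℚ * t - (2ℚ * - f p + - f (next p) + - f (prev p))) (∑cyc-neg f))
    (solve 4 (λ σ a b d → con 2ℚ :* (:- σ) :- (con 2ℚ :* (:- a) :+ (:- b) :+ (:- d))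
                        := :- (con 2ℚ :* σ :- (con 2ℚ :* a :+ b :+ d))) refl (∑cyc f) (f p) (f (next p)) (f (prev p)))

  distSum-δ : ∀ p q → p < N → q < N → distSum p (λ s → δ s q) ≡ cycleDistℚ p q
  distSum-δ p q lp lq = begin
    distSum p (λ s → δ s q)                 ≡⟨ ∑cyc-cycleDist p (λ s → δ s q) lp ⟨
    ∑cyc (λ s → cycleDistℚ p s * δ s q)    ≡⟨ ∑cyc-cong _ _ (λ s _ → ℚP.*-comm (cycleDistℚ p s) (δ s q)) ⟩
    ∑cyc (λ s → δ s q * cycleDistℚ p s)    ≡⟨ ∑cyc-δʳ q (cycleDistℚ p) lq ⟩
    cycleDistℚ p q                          ∎
    where open ≡-Reasoning

  ∑cyc-1+cycleDist : ∀ p (f : ℕ → ℚ) → p < N → ∑cyc (λ s → fromℕ (suc (cycleDist p s)) * f s) ≡ ∑cyc f + distSum p f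
  ∑cyc-1+cycleDist p f lp = begin
    ∑cyc (λ s → fromℕ (suc (cycleDist p s)) * f s) ≡⟨ ∑cyc-cong _ _ (λ s _ → distrib s) ⟩
    ∑cyc (λ s → f s + cycleDistℚ p s * f s)        ≡⟨ ∑cyc-+ f _ ⟩
    ∑cyc f + ∑cyc (λ s → cycleDistℚ p s * f s)     ≡⟨ cong (∑cyc f +_) (∑cyc-cycleDist p f lp) ⟩
    ∑cyc f + distSum p f                            ∎
    where
    open ≡-Reasoning
    distrib : ∀ s → fromℕ (suc (cycleDist p s)) * f s ≡ f s + cycleDistℚ p s * f s
    distrib s rewrite fromℕ-suc (cycleDist p s) =
      solve 2 (λ c x → (con 1ℚ :+ c) :* x := x :+ c :* x) refl (cycleDistℚ p s) (f s)

  ∑cyc-pendantDist : ∀ p (f : ℕ → ℚ) → p < N →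
    ∑cyc (λ s → distℚ (pendant p) (pendant s) * f s) ≡ distSum p f + (2ℚ * ∑cyc f - 2ℚ * f p)
  ∑cyc-pendantDist p f lp = begin
    ∑cyc (λ s → distℚ (pendant p) (pendant s) * f s)
      ≡⟨ ∑cyc-cong _ _ (λ s _ → trans (cong (_* f s) (distℚ-pendant-pendant p s)) (distrib s)) ⟩
    ∑cyc (λ s → cycleDistℚ p s * f s + (2ℚ * f s - 2ℚ * (δ p s * f s)))
      ≡⟨ ∑cyc-+ _ _ ⟩
    ∑cyc (λ s → cycleDistℚ p s * f s) + ∑cyc (λ s → 2ℚ * f s - 2ℚ * (δ p s * f s))
      ≡⟨ cong₂ _+_ (∑cyc-cycleDist p f lp)
           (trans (∑cyc-sub _ _) (cong₂ _-_ (∑cyc-* 2ℚ f) (trans (∑cyc-* 2ℚ _) (cong (2ℚ *_) (∑cyc-δˡ p f lp))))) ⟩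
    distSum p f + (2ℚ * ∑cyc f - 2ℚ * f p) ∎
    where
    open ≡-Reasoning
    distrib : ∀ s → (cycleDistℚ p s + (2ℚ - 2ℚ * δ p s)) * f s ≡ cycleDistℚ p s * f s + (2ℚ * f s - 2ℚ * (δ p s * f s))
    distrib s = solve 3 (λ c e x → (c :+ (con 2ℚ :- con 2ℚ :* e)) :* x := c :* x :+ (con 2ℚ :* x :- con 2ℚ :* (e :* x)))
                  refl (cycleDistℚ p s) (δ p s) (f s)

  ∑V : (Vertex → ℚ) → ℚ
  ∑V F = F centre + ∑cyc (F ∘ hub) + ∑cyc (F ∘ pendant)

  ∑V-cong : ∀ (F G : Vertex → ℚ) → (∀ z → F z ≡ G z) → ∑V F ≡ ∑V G
  ∑V-cong F G e = cong₂ _+_ (cong₂ _+_ (e centre) (∑cyc-cong _ _ (λ s _ → e (hub s)))) (∑cyc-cong _ _ (λ s _ → e (pendant s)))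

  ∑V-linear : ∀ a b (F G : Vertex → ℚ) → ∑V (λ z → a * F z + b * G z) ≡ a * ∑V F + b * ∑V G
  ∑V-linear a b F G = trans (cong₂ (λ x y → a * F centre + b * G centre + x + y)
      (trans (∑cyc-+ (λ s → a * F (hub s)) (λ s → b * G (hub s))) (cong₂ _+_ (∑cyc-* a _) (∑cyc-* b _)))
      (trans (∑cyc-+ (λ s → a * F (pendant s)) (λ s → b * G (pendant s))) (cong₂ _+_ (∑cyc-* a _) (∑cyc-* b _))))
    (solve 8 (λ a b fc gc fh gh fp gp → a :* fc :+ b :* gc :+ (a :* fh :+ b :* gh) :+ (a :* fp :+ b :* gp)
        := a :* (fc :+ fh :+ fp) :+ b :* (gc :+ gh :+ gp)) refl a b (F centre) (G centre)
        (∑cyc (F ∘ hub)) (∑cyc (G ∘ hub)) (∑cyc (F ∘ pendant)) (∑cyc (G ∘ pendant)))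

  ∑V-dist-centre : ∀ (G : Vertex → ℚ) {Σh Σp} → ∑cyc (G ∘ hub) ≡ Σh → ∑cyc (G ∘ pendant) ≡ Σp →
    ∑V (λ z → distℚ centre z * G z) ≡ Σh + 2ℚ * Σp
  ∑V-dist-centre G refl refl = trans
    (cong₂ (λ x y → fromℕ 0 * G centre + x + y) (∑cyc-cong _ _ (λ s _ → ℚP.*-identityˡ (G (hub s)))) (∑cyc-* 2ℚ (G ∘ pendant)))
    (solve 3 (λ c x y → con (fromℕ 0) :* c :+ x :+ con 2ℚ :* y := x :+ con 2ℚ :* y) refl (G centre) (∑cyc (G ∘ hub)) (∑cyc (G ∘ pendant)))

  ∑V-dist-hub : ∀ p (G : Vertex → ℚ) {gc dh Σp dp} → p < N →
    G centre ≡ gc → distSum p (G ∘ hub) ≡ dh → ∑cyc (G ∘ pendant) ≡ Σp → distSum p (G ∘ pendant) ≡ dp →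
    ∑V (λ z → distℚ (hub p) z * G z) ≡ gc + dh + (Σp + dp)
  ∑V-dist-hub p G lp refl refl refl refl =
    cong₂ _+_ (cong₂ _+_ (ℚP.*-identityˡ (G centre)) (∑cyc-cycleDist p (G ∘ hub) lp)) (∑cyc-1+cycleDist p (G ∘ pendant) lp)

  ∑V-dist-pendant : ∀ p (G : Vertex → ℚ) {gc Σh dh dp Σp gp} → p < N →
    G centre ≡ gc → ∑cyc (G ∘ hub) ≡ Σh → distSum p (G ∘ hub) ≡ dh →
    distSum p (G ∘ pendant) ≡ dp → ∑cyc (G ∘ pendant) ≡ Σp → G (pendant p) ≡ gp →
    ∑V (λ z → distℚ (pendant p) z * G z) ≡ 2ℚ * gc + (Σh + dh) + (dp + (2ℚ * Σp - 2ℚ * gp))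
  ∑V-dist-pendant p G lp refl refl refl refl refl refl =
    cong₂ _+_ (cong (2ℚ * G centre +_) (∑cyc-1+cycleDist p (G ∘ hub) lp)) (∑cyc-pendantDist p (G ∘ pendant) lp)

  lapHub : ℕ → ℕ → ℚ
  lapHub s q = lap (hub s) (hub q)

  δ-offset : ∀ p q → p < N → q < N → δ (offset p q) 0 ≡ δ p q
  δ-offset p q lp lq with p ℕP.≟ q
  ... | yes refl = trans (cong (λ t → δ t 0) (offset-refl p lp)) (sym (δ-refl p))
  ... | no ne = trans (δ-≢ _ 0 (λ z → ne (offset≡0⇒≡ p q lp lq z))) (sym (δ-≢ p q ne))

  lapHub-secondDifference : ∀ p q → p < N → q < N →
    lapHub (prev p) q + lapHub (next p) q + (lapHub p q + lapHub p q) ≡ (δ p q + δ p q) + (δ (prev p) q + δ (next p) q + (δ p q + δ p q))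
  lapHub-secondDifference p q lp lq = begin
    lapHub (prev p) q + lapHub (next p) q + (lapHub p q + lapHub p q)
      ≡⟨ cong₂ _+_ (cong₂ _+_ (lap-hub-hub (prev p) q (prev<N p lp) lq) (lap-hub-hub (next p) q (next<N p lp) lq))
                   (cong₂ _+_ (lap-hub-hub p q lp lq) (lap-hub-hub p q lp lq)) ⟩
    (circEntry (offset (prev p) q) + δ⁻) + (circEntry (offset (next p) q) + δ⁺) + ((circEntry r + δ₀) + (circEntry r + δ₀))
      ≡⟨ cong₂ (λ a b → (circEntry a + δ⁻) + (circEntry b + δ⁺) + ((circEntry r + δ₀) + (circEntry r + δ₀)))
           (offset-prev p q lp lq) (offset-next p q lp lq) ⟩
    (circEntry (next r) + δ⁻) + (circEntry (prev r) + δ⁺) + ((circEntry r + δ₀) + (circEntry r + δ₀))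
      ≡⟨ solve 6 (λ cn d⁻ cp d⁺ c d → (cn :+ d⁻) :+ (cp :+ d⁺) :+ ((c :+ d) :+ (c :+ d))
                                    := (cp :+ cn :+ (c :+ c)) :+ (d⁻ :+ d⁺ :+ (d :+ d)))
           refl (circEntry (next r)) δ⁻ (circEntry (prev r)) δ⁺ (circEntry r) δ₀ ⟩
    (circEntry (prev r) + circEntry (next r) + (circEntry r + circEntry r)) + (δ⁻ + δ⁺ + (δ₀ + δ₀))
      ≡⟨ cong (_+ (δ⁻ + δ⁺ + (δ₀ + δ₀)))
           (trans (circEntry-secondDifference r (offset<N p q lp lq)) (cong (λ t → t + t) (δ-offset p q lp lq))) ⟩
    (δ₀ + δ₀) + (δ⁻ + δ⁺ + (δ₀ + δ₀)) ∎
    where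
    open ≡-Reasoning
    r = offset p q
    δ₀ = δ p q
    δ⁻ = δ (prev p) q
    δ⁺ = δ (next p) q

  3/2 : ℚ
  3/2 = (ℤ.+ 3) ℚ./ 2

  -- Summing lapHub-secondDifference over p, where shifts preserve ∑cyc, gives 4 S = 6.
  ∑cyc-lapHub : ∀ q → q < N → ∑cyc (λ s → lapHub s q) ≡ 3/2
  ∑cyc-lapHub q lq = begin
    S                      ≡⟨ solve 1 (λ x → x := con ¼ :* (x :+ x :+ (x :+ x))) refl S ⟩
    ¼ * (S + S + (S + S))  ≡⟨ cong (¼ *_) (∑cyc-neighbours (λ t → lapHub t q)) ⟨
    ¼ * ∑cyc (λ p → lapHub (prev p) q + lapHub (next p) q + (lapHub p q + lapHub p q))
      ≡⟨ cong (¼ *_) (∑cyc-cong _ _ (λ p lp → lapHub-secondDifference p q lp lq)) ⟩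
    ¼ * ∑cyc (λ p → (δ p q + δ p q) + (δ (prev p) q + δ (next p) q + (δ p q + δ p q)))
      ≡⟨ cong (¼ *_) (trans (∑cyc-+ _ _) (cong₂ _+_ (trans (∑cyc-+ _ _) (cong₂ _+_ Σδ Σδ))
                                                    (trans (∑cyc-neighbours (λ t → δ t q)) (cong (λ t → t + t + (t + t)) Σδ)))) ⟩
    ¼ * ((1ℚ + 1ℚ) + (1ℚ + 1ℚ + (1ℚ + 1ℚ)))
      ≡⟨⟩
    3/2 ∎
    where
    open ≡-Reasoning
    S = ∑cyc (λ s → lapHub s q)
    Σδ = ∑cyc-δ q lq

  distSum-lapHub : ∀ p q → p < N → q < N → distSum p (λ s → lapHub s q) ≡ 1ℚ - 2ℚ * δ p q + cycleDistℚ p q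
  distSum-lapHub p q lp lq = begin
    2ℚ * ∑cyc (λ s → lapHub s q) - (2ℚ * lapHub p q + lapHub (next p) q + lapHub (prev p) q)
      ≡⟨ cong₂ (λ a b → 2ℚ * a - b) (∑cyc-lapHub q lq)
           (trans (solve 3 (λ a b d → con 2ℚ :* a :+ b :+ d := d :+ b :+ (a :+ a)) refl
                    (lapHub p q) (lapHub (next p) q) (lapHub (prev p) q))
                  (lapHub-secondDifference p q lp lq)) ⟩
    2ℚ * 3/2 - ((δ p q + δ p q) + (δ (prev p) q + δ (next p) q + (δ p q + δ p q)))
      ≡⟨ solve 3 (λ e en ep → con 2ℚ :* con 3/2 :- ((e :+ e) :+ (ep :+ en :+ (e :+ e)))
                            := con 1ℚ :- con 2ℚ :* e :+ (con 2ℚ :- (con 2ℚ :* e :+ en :+ ep)))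
           refl (δ p q) (δ (next p) q) (δ (prev p) q) ⟩
    1ℚ - 2ℚ * δ p q + (2ℚ - (2ℚ * δ p q + δ (next p) q + δ (prev p) q))
      ≡⟨ cong (1ℚ - 2ℚ * δ p q +_) (cycleDistℚ≡ p q lp lq) ⟨
    1ℚ - 2ℚ * δ p q + cycleDistℚ p q ∎
    where open ≡-Reasoning

  ∑cyc-negδ : ∀ q → q < N → ∑cyc (λ s → - δ s q) ≡ - 1ℚ
  ∑cyc-negδ q lq = trans (∑cyc-neg (λ s → δ s q)) (cong -_ (∑cyc-δ q lq))

  distSum-negδ : ∀ p q → p < N → q < N → distSum p (λ s → - δ s q) ≡ - cycleDistℚ p q
  distSum-negδ p q lp lq = trans (distSum-neg p (λ s → δ s q)) (cong -_ (distSum-δ p q lp lq))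

  ∑cyc-lap-pendant-hub : ∀ q → q < N → ∑cyc (λ s → lap (pendant s) (hub q)) ≡ - 1ℚ
  ∑cyc-lap-pendant-hub q lq = trans (∑cyc-cong _ _ (λ s ls → lap-pendant-hub s q ls lq)) (∑cyc-negδ q lq)

  distSum-lap-pendant-hub : ∀ p q → p < N → q < N → distSum p (λ s → lap (pendant s) (hub q)) ≡ - cycleDistℚ p q
  distSum-lap-pendant-hub p q lp lq = trans (distSum-cong p _ _ lp (λ s ls → lap-pendant-hub s q ls lq)) (distSum-negδ p q lp lq)

  ∑cyc-lap-hub-pendant : ∀ q → q < N → ∑cyc (λ s → lap (hub s) (pendant q)) ≡ - 1ℚ
  ∑cyc-lap-hub-pendant q lq = trans (∑cyc-cong _ _ (λ s ls → lap-hub-pendant s q ls lq)) (∑cyc-negδ q lq)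

  distSum-lap-hub-pendant : ∀ p q → p < N → q < N → distSum p (λ s → lap (hub s) (pendant q)) ≡ - cycleDistℚ p q
  distSum-lap-hub-pendant p q lp lq = trans (distSum-cong p _ _ lp (λ s ls → lap-hub-pendant s q ls lq)) (distSum-negδ p q lp lq)

  ∑cyc-lap-pendant-pendant : ∀ q → q < N → ∑cyc (λ s → lap (pendant s) (pendant q)) ≡ 1ℚ
  ∑cyc-lap-pendant-pendant q lq = trans (∑cyc-cong _ _ (λ s ls → lap-pendant-pendant s q ls lq)) (∑cyc-δ q lq)

  distSum-lap-pendant-pendant : ∀ p q → p < N → q < N → distSum p (λ s → lap (pendant s) (pendant q)) ≡ cycleDistℚ p q
  distSum-lap-pendant-pendant p q lp lq = trans (distSum-cong p _ _ lp (λ s ls → lap-pendant-pendant s q ls lq)) (distSum-δ p q lp lq)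

  κ : ℚ
  κ = fromℕ 3 * Nℚ * ¼

  ∑V-dist-u : ∀ x → IsVertex x → ∑V (λ z → distℚ x z * u z) ≡ κ
  ∑V-dist-u centre _ = trans (∑V-dist-centre u Σh Σp)
    (solve 1 (λ x → x :* con u-hub :+ con 2ℚ :* (x :* con u-pendant) := con (fromℕ 3) :* x :* con ¼) refl Nℚ)
    where
    Σh = ∑cyc-constant _ u-hub u-at-hub
    Σp = ∑cyc-constant _ u-pendant (λ s _ → u-at-pendant s)
  ∑V-dist-u (hub p) lp = trans (∑V-dist-hub p u lp u-centre≡ (distSum-constant p _ u-hub lp u-at-hub) Σp
                                  (distSum-constant p _ u-pendant lp (λ s _ → u-at-pendant s)))
    (solve 1 (λ x → (con (fromℕ 5) :- (con 1ℚ :+ x)) :* con ¼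
                    :+ (con 2ℚ :* (x :* con u-hub) :- (con 2ℚ :* con u-hub :+ con u-hub :+ con u-hub))
                    :+ (x :* con u-pendant :+ (con 2ℚ :* (x :* con u-pendant) :- (con 2ℚ :* con u-pendant :+ con u-pendant :+ con u-pendant)))
                    := con (fromℕ 3) :* x :* con ¼) refl Nℚ)
    where
    Σp = ∑cyc-constant _ u-pendant (λ s _ → u-at-pendant s)
  ∑V-dist-u (pendant p) lp = trans (∑V-dist-pendant p u lp u-centre≡ (∑cyc-constant _ u-hub u-at-hub)
                                      (distSum-constant p _ u-hub lp u-at-hub) (distSum-constant p _ u-pendant lp (λ s _ → u-at-pendant s))
                                      (∑cyc-constant _ u-pendant (λ s _ → u-at-pendant s)) (u-at-pendant p))
    (solve 1 (λ x → con 2ℚ :* ((con (fromℕ 5) :- (con 1ℚ :+ x)) :* con ¼)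
                    :+ (x :* con u-hub :+ (con 2ℚ :* (x :* con u-hub) :- (con 2ℚ :* con u-hub :+ con u-hub :+ con u-hub)))
                    :+ ((con 2ℚ :* (x :* con u-pendant) :- (con 2ℚ :* con u-pendant :+ con u-pendant :+ con u-pendant))
                       :+ (con 2ℚ :* (x :* con u-pendant) :- con 2ℚ :* con u-pendant))
                    := con (fromℕ 3) :* x :* con ¼) refl Nℚ)

  ∑V-dist-lap-centre : ∀ x → IsVertex x → ∑V (λ z → distℚ x z * lap z centre) ≡ 2ℚ * u-centre - 2ℚ * identityV x centre
  ∑V-dist-lap-centre centre _ = trans (∑V-dist-centre (λ z → lap z centre) Σh Σp)
    (trans (solve 1 (λ x → x :* con spokeEntry :+ con 2ℚ :* (x :* con 0ℚ)
                         := con 2ℚ :* ((con (fromℕ 5) :- (con 1ℚ :+ x)) :* con ¼) :- con 2ℚ :* con 1ℚ) refl Nℚ)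
           (cong (λ t → 2ℚ * t - 2ℚ * 1ℚ) (sym u-centre≡)))
    where
    Σh = ∑cyc-constant _ spokeEntry lap-hub-centre
    Σp = ∑cyc-constant _ 0ℚ lap-pendant-centre
  ∑V-dist-lap-centre (hub p) lp = trans (∑V-dist-hub p (λ z → lap z centre) lp lap-centre-centre (distSum-constant p _ spokeEntry lp lap-hub-centre)
                                          (∑cyc-constant _ 0ℚ lap-pendant-centre) (distSum-constant p _ 0ℚ lp lap-pendant-centre))
    (trans (solve 1 (λ x → con ½ :* x :+ (con 2ℚ :* (x :* con spokeEntry) :- (con 2ℚ :* con spokeEntry :+ con spokeEntry :+ con spokeEntry))
                         :+ (x :* con 0ℚ :+ (con 2ℚ :* (x :* con 0ℚ) :- (con 2ℚ :* con 0ℚ :+ con 0ℚ :+ con 0ℚ)))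
                         := con 2ℚ :* ((con (fromℕ 5) :- (con 1ℚ :+ x)) :* con ¼) :- con 2ℚ :* con 0ℚ) refl Nℚ)
           (cong (λ t → 2ℚ * t - 2ℚ * 0ℚ) (sym u-centre≡)))
  ∑V-dist-lap-centre (pendant p) lp = trans (∑V-dist-pendant p (λ z → lap z centre) lp lap-centre-centre (∑cyc-constant _ spokeEntry lap-hub-centre)
                                              (distSum-constant p _ spokeEntry lp lap-hub-centre) (distSum-constant p _ 0ℚ lp lap-pendant-centre)
                                              (∑cyc-constant _ 0ℚ lap-pendant-centre) (lap-pendant-centre p lp))
    (trans (solve 1 (λ x → con 2ℚ :* (con ½ :* x)
                         :+ (x :* con spokeEntry :+ (con 2ℚ :* (x :* con spokeEntry) :- (con 2ℚ :* con spokeEntry :+ con spokeEntry :+ con spokeEntry)))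
                         :+ ((con 2ℚ :* (x :* con 0ℚ) :- (con 2ℚ :* con 0ℚ :+ con 0ℚ :+ con 0ℚ)) :+ (con 2ℚ :* (x :* con 0ℚ) :- con 2ℚ :* con 0ℚ))
                         := con 2ℚ :* ((con (fromℕ 5) :- (con 1ℚ :+ x)) :* con ¼) :- con 2ℚ :* con 0ℚ) refl Nℚ)
           (cong (λ t → 2ℚ * t - 2ℚ * 0ℚ) (sym u-centre≡)))

  ∑V-dist-lap-hub : ∀ x q → IsVertex x → q < N → ∑V (λ z → distℚ x z * lap z (hub q)) ≡ 2ℚ * u-hub - 2ℚ * identityV x (hub q)
  ∑V-dist-lap-hub centre q _ lq = ∑V-dist-centre (λ z → lap z (hub q)) (∑cyc-lapHub q lq) (∑cyc-lap-pendant-hub q lq)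
  ∑V-dist-lap-hub (hub p) q lp lq = trans (∑V-dist-hub p (λ z → lap z (hub q)) lp (lap-centre-hub q lq) (distSum-lapHub p q lp lq) (∑cyc-lap-pendant-hub q lq) (distSum-lap-pendant-hub p q lp lq))
    (solve 2 (λ e c → con spokeEntry :+ (con 1ℚ :- con 2ℚ :* e :+ c) :+ (:- con 1ℚ :+ :- c) := con 2ℚ :* con u-hub :- con 2ℚ :* e)
      refl (δ p q) (cycleDistℚ p q))
  ∑V-dist-lap-hub (pendant p) q lp lq = trans (∑V-dist-pendant p (λ z → lap z (hub q)) lp (lap-centre-hub q lq) (∑cyc-lapHub q lq) (distSum-lapHub p q lp lq)
                                                 (distSum-lap-pendant-hub p q lp lq) (∑cyc-lap-pendant-hub q lq) (lap-pendant-hub p q lp lq))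
    (trans (solve 2 (λ e c → con 2ℚ :* con spokeEntry :+ (con 3/2 :+ (con 1ℚ :- con 2ℚ :* e :+ c))
                           :+ (:- c :+ (con 2ℚ :* (:- con 1ℚ) :- con 2ℚ :* (:- e))) := con 2ℚ :* con u-hub :- con 2ℚ :* con 0ℚ)
             refl (δ p q) (cycleDistℚ p q))
           (cong (λ t → 2ℚ * u-hub - 2ℚ * t) (sym (identityV-pendant-hub p q lq))))

  ∑V-dist-lap-pendant : ∀ x q → IsVertex x → q < N → ∑V (λ z → distℚ x z * lap z (pendant q)) ≡ 2ℚ * u-pendant - 2ℚ * identityV x (pendant q)
  ∑V-dist-lap-pendant centre q _ lq = ∑V-dist-centre (λ z → lap z (pendant q)) (∑cyc-lap-hub-pendant q lq) (∑cyc-lap-pendant-pendant q lq)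
  ∑V-dist-lap-pendant (hub p) q lp lq = trans (∑V-dist-hub p (λ z → lap z (pendant q)) lp (lap-centre-pendant q) (distSum-lap-hub-pendant p q lp lq)
                                                 (∑cyc-lap-pendant-pendant q lq)
                                                 (distSum-lap-pendant-pendant p q lp lq))
    (trans (solve 1 (λ c → con 0ℚ :+ (:- c) :+ (con 1ℚ :+ c) := con 2ℚ :* con u-pendant :- con 2ℚ :* con 0ℚ) refl (cycleDistℚ p q))
           (cong (λ t → 2ℚ * u-pendant - 2ℚ * t) (sym (identityV-hub-pendant p q lp))))
  ∑V-dist-lap-pendant (pendant p) q lp lq = trans (∑V-dist-pendant p (λ z → lap z (pendant q)) lp (lap-centre-pendant q) (∑cyc-lap-hub-pendant q lq) (distSum-lap-hub-pendant p q lp lq)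
                                                     (distSum-lap-pendant-pendant p q lp lq)
                                                     (∑cyc-lap-pendant-pendant q lq)
                                                     (lap-pendant-pendant p q lp lq))
    (trans (solve 2 (λ e c → con 2ℚ :* con 0ℚ :+ (:- con 1ℚ :+ :- c) :+ (c :+ (con 2ℚ :* con 1ℚ :- con 2ℚ :* e))
                           := con 2ℚ :* con u-pendant :- con 2ℚ :* e) refl (δ p q) (cycleDistℚ p q))
           (cong (λ t → 2ℚ * u-pendant - 2ℚ * t) (sym (identityV-pendant-pendant p q))))

  ∑V-dist-lap : ∀ x y → IsVertex x → IsVertex y → ∑V (λ z → distℚ x z * lap z y) ≡ 2ℚ * u y - 2ℚ * identityV x y
  ∑V-dist-lap x centre vx _ = ∑V-dist-lap-centre x vx
  ∑V-dist-lap x (hub q) vx lq = trans (∑V-dist-lap-hub x q vx lq) (cong (λ t → 2ℚ * t - 2ℚ * identityV x (hub q)) (sym (u-at-hub q lq)))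
  ∑V-dist-lap x (pendant q) vx lq = trans (∑V-dist-lap-pendant x q vx lq) (cong (λ t → 2ℚ * t - 2ℚ * identityV x (pendant q)) (sym (u-at-pendant q)))

  α : ℚ
  α = (ℤ.+ 4) ℚ./ suc (3 ℕ.* (n ∸ 1) ∸ 1)

  recip3N : ℚ
  recip3N = (ℤ.+ 1) ℚ./ suc (3 ℕ.* N ∸ 1)

  ακ≡1 : α * κ ≡ 1ℚ
  ακ≡1 = begin
    α * κ                                       ≡⟨ cong (_* κ) (/-as-* (ℤ.+ 4) (3 ℕ.* N ∸ 1)) ⟩
    fromℕ 4 * recip3N * (fromℕ 3 * Nℚ * ¼)     ≡⟨ solve 2 (λ x r → con (fromℕ 4) :* r :* (con (fromℕ 3) :* x :* con ¼)
                                                                 := con (fromℕ 3) :* x :* r) refl Nℚ recip3N ⟩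
    fromℕ 3 * Nℚ * recip3N                     ≡⟨ cong (_* recip3N) (fromℕ-* 3 N) ⟨
    fromℕ (3 ℕ.* N) * recip3N                   ≡⟨ fromℕ-*-recip (3 ℕ.* N ∸ 1) ⟩
    1ℚ                                          ∎
    where open ≡-Reasoning

  candidate : Vertex → Vertex → ℚ
  candidate z y = (- ½) * lap z y + α * (u z * u y)

  ∑V-dist-candidate : ∀ x y → IsVertex x → IsVertex y → ∑V (λ z → distℚ x z * candidate z y) ≡ identityV x y
  ∑V-dist-candidate x y vx vy = begin
    ∑V (λ z → distℚ x z * candidate z y)
      ≡⟨ ∑V-cong _ _ distrib ⟩
    ∑V (λ z → (- ½) * (distℚ x z * lap z y) + (α * u y) * (distℚ x z * u z))
      ≡⟨ ∑V-linear (- ½) (α * u y) (λ z → distℚ x z * lap z y) (λ z → distℚ x z * u z) ⟩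
    (- ½) * ∑V (λ z → distℚ x z * lap z y) + (α * u y) * ∑V (λ z → distℚ x z * u z)
      ≡⟨ cong₂ (λ a b → (- ½) * a + (α * u y) * b) (∑V-dist-lap x y vx vy) (∑V-dist-u x vx) ⟩
    (- ½) * (2ℚ * u y - 2ℚ * identityV x y) + (α * u y) * κ
      ≡⟨ solve 4 (λ a k w e → (:- con ½) :* (con 2ℚ :* w :- con 2ℚ :* e) :+ (a :* w) :* k := e :+ w :* (a :* k :- con 1ℚ))
           refl α κ (u y) (identityV x y) ⟩
    identityV x y + u y * (α * κ - 1ℚ)
      ≡⟨ cong (λ t → identityV x y + u y * (t - 1ℚ)) ακ≡1 ⟩
    identityV x y + u y * (1ℚ - 1ℚ)
      ≡⟨ solve 2 (λ e w → e :+ w :* (con 1ℚ :- con 1ℚ) := e) refl (identityV x y) (u y) ⟩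
    identityV x y ∎
    where
    open ≡-Reasoning
    distrib : ∀ z → distℚ x z * candidate z y ≡ (- ½) * (distℚ x z * lap z y) + (α * u y) * (distℚ x z * u z)
    distrib z = solve 5 (λ d l a uz uy → d :* ((:- con ½) :* l :+ a :* (uz :* uy)) := (:- con ½) :* (d :* l) :+ (a :* uy) :* (d :* uz))
                  refl (distℚ x z) (lap z y) α (u z) (u y)

  candidate-sym : ∀ x y → IsVertex x → IsVertex y → candidate x y ≡ candidate y x
  candidate-sym x y vx vy = cong₂ (λ a b → (- ½) * a + α * b) (lap-sym x y vx vy) (ℚP.*-comm (u x) (u y))

  distℚ-sym : ∀ x y → distℚ x y ≡ distℚ y x
  distℚ-sym x y = cong fromℕ (dist-sym x y)

  identityV-sym : ∀ x y → identityV x y ≡ identityV y x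
  identityV-sym x y = cong (λ b → if b then 1ℚ else 0ℚ) (≡ᵇ-sym (index x) (index y))

  sumFin≡∑V : ∀ (g : Fin m → ℚ) (Fv : Vertex → ℚ) → (∀ l z → IsVertex z → toℕ l ≡ index z → g l ≡ Fv z) → sumFin g ≡ ∑V Fv
  sumFin≡∑V g Fv e = trans (sumFin≡sumℕ m g G pw)
    (trans (cong (λ k → sumℕ k G) m≡1+N+N)
    (trans (cong (λ t → G 0 + t) (sumℕ-split N N (λ t → G (suc t))))
    (trans (cong₂ (λ a b → Fv centre + (a + b))
        (trans (sumℕ-cong N _ _ (λ t lt → cong Fv (vertexAt-index (hub t) lt))) (sym (∑cyc-def (λ s → Fv (hub s)))))
        (trans (sumℕ-cong N _ _ (λ t lt → cong Fv (vertexAt-index (pendant t) lt))) (sym (∑cyc-def (λ s → Fv (pendant s))))))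
      (sym (ℚP.+-assoc (Fv centre) _ _)))))
    where
    G : ℕ → ℚ
    G t = Fv (vertexAt t)
    pw : ∀ l → g l ≡ G (toℕ l)
    pw l with vertexOfFin l
    ... | (z , vz , ez) = trans (e l z vz ez) (cong Fv (sym (trans (cong vertexAt ez) (vertexAt-index z vz))))

  helmDist-vertex : ∀ {i l : Fin m} {x z} → IsVertex x → IsVertex z → toℕ i ≡ index x → toℕ l ≡ index z →
    helmDist n i l ≡ distℚ x z
  helmDist-vertex {i} {l} vx vz ei ez = cong fromℕ (trans (graphDist≡distFin i l) (distFin≡dist vx vz ei ez))

  candidateInverse-vertex : ∀ {l j : Fin m} {z y} → toℕ l ≡ index z → toℕ j ≡ index y → candidateInverse n l j ≡ candidate z y
  candidateInverse-vertex ez ej = cong₂ (λ a b → (- ½) * lapℕ a b + α * (uℕ a * uℕ b)) (cong suc ez) (cong suc ej)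

  identity-vertex : ∀ {i j : Fin m} {x y} → toℕ i ≡ index x → toℕ j ≡ index y → identity i j ≡ identityV x y
  identity-vertex ei ej = cong₂ (λ a b → if a ≡ᵇ b then 1ℚ else 0ℚ) ei ej

  helmDist·candidateInverse-vertex : ∀ {i j : Fin m} {x y} → IsVertex x → IsVertex y → toℕ i ≡ index x → toℕ j ≡ index y →
    (helmDist n · candidateInverse n) i j ≡ identity i j
  helmDist·candidateInverse-vertex {i} {j} {x} {y} vx vy ei ej = begin
    (helmDist n · candidateInverse n) i j ≡⟨ sumFin≡∑V (λ l → helmDist n i l * candidateInverse n l j) _ entry ⟩
    ∑V (λ z → distℚ x z * candidate z y)  ≡⟨ ∑V-dist-candidate x y vx vy ⟩
    identityV x y                          ≡⟨ identity-vertex ei ej ⟨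
    identity i j                           ∎
    where
    open ≡-Reasoning
    entry : ∀ l z → IsVertex z → toℕ l ≡ index z → helmDist n i l * candidateInverse n l j ≡ distℚ x z * candidate z y
    entry l z vz ez = cong₂ _*_ (helmDist-vertex vx vz ei ez) (candidateInverse-vertex ez ej)

  candidateInverse·helmDist-vertex : ∀ {i j : Fin m} {x y} → IsVertex x → IsVertex y → toℕ i ≡ index x → toℕ j ≡ index y →
    (candidateInverse n · helmDist n) i j ≡ identity i j
  candidateInverse·helmDist-vertex {i} {j} {x} {y} vx vy ei ej = begin
    (candidateInverse n · helmDist n) i j ≡⟨ sumFin≡∑V (λ l → candidateInverse n i l * helmDist n l j) _ entry ⟩
    ∑V (λ z → distℚ y z * candidate z x)  ≡⟨ ∑V-dist-candidate y x vy vx ⟩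
    identityV y x                          ≡⟨ identityV-sym y x ⟩
    identityV x y                          ≡⟨ identity-vertex ei ej ⟨
    identity i j                           ∎
    where
    open ≡-Reasoning
    entry : ∀ l z → IsVertex z → toℕ l ≡ index z → candidateInverse n i l * helmDist n l j ≡ distℚ y z * candidate z x
    entry l z vz ez = trans (ℚP.*-comm (candidateInverse n i l) (helmDist n l j))
      (cong₂ _*_ (trans (helmDist-vertex vz vy ez ej) (distℚ-sym z y))
                 (trans (candidateInverse-vertex ei ez) (candidate-sym x z vx vz)))

  -- A let rather than a with: with-abstracting vertexOfFin here makes type checking blow up.
  helmDist-inverse : TwoSidedInverse (helmDist n) (candidateInverse n)
  helmDist-inverse = (λ i j → let (_ , vx , ei) = vertexOfFin i; (_ , vy , ej) = vertexOfFin j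
                              in helmDist·candidateInverse-vertex vx vy ei ej)
                   , (λ i j → let (_ , vx , ei) = vertexOfFin i; (_ , vy , ej) = vertexOfFin j
                              in candidateInverse·helmDist-vertex vx vy ei ej)

mainTheorem2 : (n : ℕ) → 4 ≤ n → 2 ∣ n →
    (∀ i j → (helmDist n · candidateInverse n) i j ≡ identity i j)
    × (∀ i j → (candidateInverse n · helmDist n) i j ≡ identity i j)
mainTheorem2 .0 () (divides zero refl)
mainTheorem2 .2 (s≤s (s≤s ())) (divides (suc zero) refl)
mainTheorem2 .(suc (suc h) ℕ.* 2) _ (divides (suc (suc h)) refl) =
  subst (λ n → TwoSidedInverse (helmDist n) (candidateInverse n)) (sym (Helm.[2+h]*2≡n h)) (Helm.helmDist-inverse h)
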